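{- Let $k\ge 5$ be an integer and let $\Gamma^{(k)}$ be the graph defined below. For every $j\in\mathbb{Z}_{8k+4}$ and the edge $x_jx_{j+1}$: (i) $|D^1_0(x_j,x_{j+1})|=|D^0_1(x_j,x_{j+1})|=1$; (ii) $|D^2_1(x_j,x_{j+1})|=|D^1_2(x_j,x_{j+1})|=4$; (iii) $|D^3_2(x_j,x_{j+1})|=|D^2_3(x_j,x_{j+1})|=12$; (iv) $|D^4_3(x_j,x_{j+1})|=|D^3_4(x_j,x_{j+1})|=7$; (v) $|D^{\ell+1}_{\ell}(x_j,x_{j+1})|=|D^{\ell}_{\ell+1}(x_j,x_{j+1})|=6$ for all $4\le\ell\le k-1$; (vi) $|D^k_k(x_j,x_{j+1})|=6$; (vii) the edge $x_jx_{j+1}$ is balanced, and the sets $D^i_i(x_j,x_{j+1})$, $1\le i\le k-1$, are all empty.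
   Context: $\Gamma^{(k)}$ is the graph on $12k+6$ vertices $\{x_i\mid i\in\mathbb{Z}_{8k+4}\}\cup\{y_i\mid i\in\mathbb{Z}_{4k+2}\}$ with edges $x_i\sim x_{i+1}$ ($i\in\mathbb{Z}_{8k+4}$) and $y_i\sim x_{i+m}$ for $m\in\{0,2k-1,2k+1,4k+2,6k+1,6k+3\}$ (indices of $x$ modulo $8k+4$, indices of $y$ modulo $4k+2$). For adjacent $u,v$ and integers $i,j\ge0$, $D^i_j(u,v)$ is the set of vertices at distance $i$ from $u$ and distance $j$ from $v$. An edge $uv$ is balanced if $|W_{u,v}|=|W_{v,u}|$, where $W_{u,v}=\{x\mid d(x,u)<d(x,v)\}$. -}

module Defs where

open import Data.Nat using (ℕ; zero; suc; _+_; _*_; _<ᵇ_; _∸_)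
open import Data.Nat.DivMod using (_mod_)
open import Data.Fin using (Fin; toℕ)
open import Data.Fin.Properties using () renaming (_≟_ to _≟F_)
open import Data.Bool using (Bool; true; false; _∧_; _∨_; if_then_else_)
open import Data.List using (List; []; _∷_; map; _++_; filter; length; allFin)
open import Data.Bool.ListAction using (any)
open import Data.Bool using (T)
open import Data.Bool.Properties using (T?)
open import Relation.Nullary.Decidable using (⌊_⌋)
open import Data.Nat using (_≡ᵇ_)
open import Relation.Binary.PropositionalEquality using (_≡_)

NX : ℕ → ℕ
NX k = 4 + 8 * k

NY : ℕ → ℕ
NY k = 2 + 4 * k

data V (k : ℕ) : Set where
  x : Fin (NX k) → V k
  y : Fin (NY k) → V k

xv : (k : ℕ) → ℕ → V k
xv k n = x (n mod NX k)

-- the offsets m ∈ {0, 2k-1, 2k+1, 4k+2, 6k+1, 6k+3}  (2k-1 via truncated subtraction; k ≥ 5 in the theorem)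
offsets : ℕ → List ℕ
offsets k = 0 ∷ (2 * k ∸ 1) ∷ (2 * k + 1) ∷ (4 * k + 2) ∷ (6 * k + 1) ∷ (6 * k + 3) ∷ []

eqF : ∀ {n} → Fin n → Fin n → Bool
eqF a b = ⌊ a ≟F b ⌋

adjXX : (k : ℕ) → Fin (NX k) → Fin (NX k) → Bool
adjXX k a b = eqF b ((toℕ a + 1) mod NX k) ∨ eqF a ((toℕ b + 1) mod NX k)

adjYX : (k : ℕ) → Fin (NY k) → Fin (NX k) → Bool
adjYX k i a = any (λ m → eqF a ((toℕ i + m) mod NX k)) (offsets k)

adj : (k : ℕ) → V k → V k → Bool
adj k (x a) (x b) = adjXX k a b
adj k (x a) (y i) = adjYX k i a
adj k (y i) (x a) = adjYX k i a
adj k (y i) (y j) = false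

allV : (k : ℕ) → List (V k)
allV k = map x (allFin (NX k)) ++ map y (allFin (NY k))

eqV : ∀ {k} → V k → V k → Bool
eqV (x a) (x b) = eqF a b
eqV (y a) (y b) = eqF a b
eqV _ _ = false

reach : (k : ℕ) → ℕ → V k → V k → Bool
reach k zero u v = eqV u v
reach k (suc n) u v = reach k n u v ∨ any (λ w → reach k n u w ∧ adj k w v) (allV k)

-- least n < fuel with f n = true (returns fuel if none)
least : ℕ → (ℕ → Bool) → ℕ
least zero f = zero
least (suc fuel) f = if f 0 then 0 else suc (least fuel (λ n → f (suc n)))

-- graph distance d(u,v): least n with a walk of length ≤ n from u to v.
-- (Any shortest walk has length < 12k+6, the number of vertices, so the search bound suffices.)
dist : (k : ℕ) → V k → V k → ℕ
dist k u v = least (length (allV k)) (λ n → reach k n u v)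

D : (k : ℕ) → ℕ → ℕ → V k → V k → List (V k)
D k i j u v = filter (λ w → T? ((dist k u w ≡ᵇ i) ∧ (dist k v w ≡ᵇ j))) (allV k)

W : (k : ℕ) → V k → V k → List (V k)
W k u v = filter (λ w → T? (dist k u w <ᵇ dist k v w)) (allV k)

Balanced : (k : ℕ) → V k → V k → Set
Balanced k u v = length (W k u v) ≡ length (W k v u)

{-# OPTIONS --safe #-}

-- The rotation ρ : x_i ↦ x_{i+1}, y_i ↦ y_{i+1} is an automorphism of Γ^(k), so it suffices to study the
-- edge x₀x₁, and d(x₁, w) = d(x₀, ρ⁻¹ w).  The distances from x₀ are given by explicit piecewise-linear
-- formulas; they are certified to be the graph distance because they vanish only at x₀, change by at
-- most one along every edge, and every vertex with a positive value has a neighbour one step closer.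
-- Walking once around the cycle of x-vertices and once through the y-vertices and recording the pairs
-- (d(x₀, w), d(x₁, w)) yields the distance profile of the edge: (0,1), (1,0), (3,4), (4,3) once,
-- (1,2), (2,1) four times, (2,3), (3,2) twelve times, and (ℓ+1,ℓ), (ℓ,ℓ+1) for 3 ≤ ℓ < k as well as
-- (k,k) six times each.  Every claim is read off from this profile; it is symmetric under swapping
-- the two coordinates, which gives balance.

module Submission where

open import Defs
open import Data.Nat
open import Data.Nat.Properties
open import Data.Nat.DivMod
open import Data.Nat.Tactic.RingSolver using (solve-∀)
open import Data.Fin using (Fin; toℕ; fromℕ<) renaming (zero to fzero; suc to fsuc)
import Data.Fin.Properties as Finₚ
open import Data.Bool using (Bool; true; false; _∧_; _∨_; if_then_else_; T)
open import Data.Bool.Properties using (T?; T-∨; T-∧; ∧-zeroʳ; ∧-comm; ∨-comm; ∧-idem)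
open import Data.Bool.ListAction using (any; or)
open import Data.List using (List; []; _∷_; map; _++_; filter; length; allFin; tabulate)
open import Data.List.Properties using (filter-++; length-++; map-cong; length-map; length-tabulate)
open import Data.List.Membership.Propositional using (_∈_; find; lose)
open import Data.List.Membership.Propositional.Properties using (∈-map⁺; ∈-map⁻; ∈-++⁺ˡ; ∈-++⁺ʳ; ∈-allFin)
open import Data.List.Membership.Propositional.Properties.WithK using (unique∧set⇒bag)
open import Data.List.Relation.Unary.Any using (here; there)
open import Data.List.Relation.Unary.Any.Properties using (any⁺; any⁻)
open import Data.List.Relation.Unary.Unique.Propositional using (Unique)
import Data.List.Relation.Unary.Unique.Propositional.Properties as Uniqueₚ
open import Data.List.Relation.Binary.BagAndSetEquality using (∼bag⇒↭)
open import Data.List.Relation.Binary.Permutation.Propositional using (_↭_)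
open import Data.List.Relation.Binary.Permutation.Propositional.Properties using (filter-↭; ↭-length)
open import Data.Product using (∃-syntax; _×_; _,_; proj₁; proj₂)
open import Data.Sum using (_⊎_; inj₁; inj₂)
open import Data.Unit using (tt)
open import Data.Empty using (⊥; ⊥-elim)
open import Function using (_∘_; id; flip; _⇔_; mk⇔; Equivalence)
open import Relation.Binary.PropositionalEquality hiding ([_])
open import Relation.Nullary using (yes; no; ¬_)
open import Relation.Nullary.Decidable using (toWitness; fromWitness)

≤-by : ∀ {a b} c → a + c ≡ b → a ≤ b
≤-by {a} c refl = m≤m+n a c

T-ext : ∀ {b c} → (T b → T c) → (T c → T b) → b ≡ c
T-ext {false} {false} _ _ = refl
T-ext {false} {true}  _ g = ⊥-elim (g tt)
T-ext {true}  {false} f _ = ⊥-elim (f tt)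
T-ext {true}  {true}  _ _ = refl

count : ∀ {A : Set} → (A → Bool) → List A → ℕ
count f xs = length (filter (T? ∘ f) xs)

count-cong : ∀ {A : Set} {f g : A → Bool} xs → (∀ a → f a ≡ g a) → count f xs ≡ count g xs
count-cong [] f≗g = refl
count-cong {f = f} {g} (a ∷ xs) f≗g with f a | g a | f≗g a
... | true  | true  | refl = cong suc (count-cong xs f≗g)
... | false | false | refl = count-cong xs f≗g

count-map : ∀ {A B : Set} (f : B → Bool) (g : A → B) xs → count f (map g xs) ≡ count (f ∘ g) xs
count-map f g [] = refl
count-map f g (a ∷ xs) with f (g a)
... | true  = cong suc (count-map f g xs)
... | false = count-map f g xs

count-++ : ∀ {A : Set} (f : A → Bool) xs ys → count f (xs ++ ys) ≡ count f xs + count f ys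
count-++ f xs ys = trans (cong length (filter-++ (T? ∘ f) xs ys)) (length-++ (filter (T? ∘ f) xs))

eqF⇔≡ : ∀ {n} {a b : Fin n} → T (eqF a b) ⇔ a ≡ b
eqF⇔≡ = mk⇔ toWitness fromWitness

eqV⇔≡ : ∀ {k} {u v : V k} → T (eqV u v) ⇔ u ≡ v
eqV⇔≡ {u = x a} {x b} = mk⇔ (cong x ∘ toWitness) (λ { refl → fromWitness refl })
eqV⇔≡ {u = y a} {y b} = mk⇔ (cong y ∘ toWitness) (λ { refl → fromWitness refl })
eqV⇔≡ {u = x a} {y b} = mk⇔ (λ ()) (λ ())
eqV⇔≡ {u = y a} {x b} = mk⇔ (λ ()) (λ ())

∈-allV : ∀ {k} (v : V k) → v ∈ allV k
∈-allV {k} (x a) = ∈-++⁺ˡ (∈-map⁺ x (∈-allFin a))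
∈-allV {k} (y i) = ∈-++⁺ʳ (map x (allFin (NX k))) (∈-map⁺ y (∈-allFin i))

length-allV : ∀ k → length (allV k) ≡ NX k + NY k
length-allV k = begin
  length (xs ++ ys)                               ≡⟨ length-++ xs {ys} ⟩
  length xs + length ys
    ≡⟨ cong₂ _+_ (length-map (x {k}) (allFin (NX k))) (length-map (y {k}) (allFin (NY k))) ⟩
  length (allFin (NX k)) + length (allFin (NY k)) ≡⟨ cong₂ _+_ (length-tabulate {n = NX k} id) (length-tabulate {n = NY k} id) ⟩
  NX k + NY k                                     ∎
  where
    open ≡-Reasoning
    xs ys : List (V k)
    xs = map x (allFin (NX k))
    ys = map y (allFin (NY k))

allV-unique : ∀ k → Unique (allV k)
allV-unique k =
  Uniqueₚ.++⁺ (Uniqueₚ.map⁺ x-injective (Uniqueₚ.allFin⁺ _)) (Uniqueₚ.map⁺ y-injective (Uniqueₚ.allFin⁺ _)) disjoint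
  where
    x-injective : ∀ {a b} → x {k} a ≡ x b → a ≡ b
    x-injective refl = refl
    y-injective : ∀ {i j} → y {k} i ≡ y j → i ≡ j
    y-injective refl = refl
    disjoint : ∀ {v} → ¬ (v ∈ map x (allFin (NX k)) × v ∈ map y (allFin (NY k)))
    disjoint (p , q) with ∈-map⁻ x p | ∈-map⁻ y q
    ... | _ , _ , refl | _ , _ , ()

-- Graph distance

least-threshold : ∀ fuel (f : ℕ → Bool) c → c < fuel → (∀ m → T (f m) ⇔ c ≤ m) → least fuel f ≡ c
least-threshold (suc fuel) f zero _ f⇔ with f 0 | Equivalence.from (f⇔ 0) z≤n
... | true | _ = refl
least-threshold (suc fuel) f (suc c) c<fuel f⇔ with f 0 | Equivalence.to (f⇔ 0)
... | false | _ = cong suc (least-threshold fuel (f ∘ suc) c (≤-pred c<fuel)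
                    (λ m → mk⇔ (≤-pred ∘ Equivalence.to (f⇔ (suc m))) (Equivalence.from (f⇔ (suc m)) ∘ s≤s)))
... | true  | f0⇒ with f0⇒ tt
...   | ()

least-cong : ∀ fuel {f g : ℕ → Bool} → (∀ m → f m ≡ g m) → least fuel f ≡ least fuel g
least-cong zero f≗g = refl
least-cong (suc fuel) {f} {g} f≗g rewrite f≗g 0 =
  cong (λ r → if g 0 then 0 else suc r) (least-cong fuel (f≗g ∘ suc))

record DistanceLabelling (k : ℕ) (u : V k) : Set where
  field
    label : V k → ℕ
    label-source : label u ≡ 0
    label≡0⇒source : ∀ v → label v ≡ 0 → v ≡ u
    label-edge : ∀ w v → T (adj k w v) → label v ≤ suc (label w)
    label-parent : ∀ v m → label v ≡ suc m → ∃[ w ] T (adj k w v) × label w ≡ m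
    label<size : ∀ v → label v < length (allV k)

  reach⇔label≤ : ∀ m v → T (reach k m u v) ⇔ label v ≤ m
  reach⇔label≤ zero v = mk⇔
    (λ r → subst (λ w → label w ≤ 0) (Equivalence.to eqV⇔≡ r) (≤-reflexive label-source))
    (λ l → Equivalence.from eqV⇔≡ (sym (label≡0⇒source v (n≤0⇒n≡0 l))))
  reach⇔label≤ (suc m) v = mk⇔ sound complete
    where
      via : V k → Bool
      via w = reach k m u w ∧ adj k w v
      sound : T (reach k (suc m) u v) → label v ≤ suc m
      sound r with Equivalence.to (T-∨ {reach k m u v}) r
      ... | inj₁ r′ = m≤n⇒m≤1+n (Equivalence.to (reach⇔label≤ m v) r′)
      ... | inj₂ r′ with find (any⁻ via (allV k) r′)
      ...   | w , _ , t with Equivalence.to T-∧ t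
      ...     | rw , a = ≤-trans (label-edge w v a) (s≤s (Equivalence.to (reach⇔label≤ m w) rw))
      complete : label v ≤ suc m → T (reach k (suc m) u v)
      complete l with m≤n⇒m<n∨m≡n l
      ... | inj₁ (s≤s l′) = Equivalence.from (T-∨ {reach k m u v}) (inj₁ (Equivalence.from (reach⇔label≤ m v) l′))
      ... | inj₂ l≡ with label-parent v m l≡
      ...   | w , a , lw = Equivalence.from (T-∨ {reach k m u v}) (inj₂ (any⁺ via (lose {P = T ∘ via} (∈-allV w)
                (Equivalence.from T-∧ (Equivalence.from (reach⇔label≤ m w) (≤-reflexive lw) , a)))))

  dist≡label : ∀ v → dist k u v ≡ label v
  dist≡label v = least-threshold _ _ (label v) (label<size v) (λ m → reach⇔label≤ m v)

-- Automorphisms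

-- Opaque so that conversion checking compares its arguments rather than unfolding dist.
opaque
  distanceCount : ∀ k → (ℕ → ℕ → Bool) → V k → V k → ℕ
  distanceCount k Q u v = count (λ w → Q (dist k u w) (dist k v w)) (allV k)

record Automorphism (k : ℕ) : Set where
  field
    to : V k → V k
    from : V k → V k
    to-from : ∀ v → to (from v) ≡ v
    from-to : ∀ v → from (to v) ≡ v
    adj-to : ∀ u v → adj k (to u) (to v) ≡ adj k u v

  to-injective : ∀ {u v} → to u ≡ to v → u ≡ v
  to-injective {u} {v} eq = trans (sym (from-to u)) (trans (cong from eq) (from-to v))

  eqV-to : ∀ u v → eqV (to u) (to v) ≡ eqV u v
  eqV-to u v = T-ext
    (Equivalence.from eqV⇔≡ ∘ to-injective ∘ Equivalence.to eqV⇔≡)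
    (Equivalence.from eqV⇔≡ ∘ cong to ∘ Equivalence.to eqV⇔≡)

  any-to : ∀ f → any f (allV k) ≡ any (f ∘ to) (allV k)
  any-to f = T-ext
    (λ t → let w , _ , fw = find (any⁻ f (allV k) t) in
           any⁺ (f ∘ to) (lose {P = T ∘ f ∘ to} (∈-allV (from w)) (subst (T ∘ f) (sym (to-from w)) fw)))
    (λ t → let w , _ , fw = find (any⁻ (f ∘ to) (allV k) t) in
           any⁺ f (lose {P = T ∘ f} (∈-allV (to w)) fw))

  reach-to : ∀ m u v → reach k m (to u) (to v) ≡ reach k m u v
  reach-to zero u v = eqV-to u v
  reach-to (suc m) u v = cong₂ _∨_ (reach-to m u v)
    (trans (any-to (λ w → reach k m (to u) w ∧ adj k w (to v)))
           (cong or (map-cong (λ w → cong₂ _∧_ (reach-to m u w) (adj-to w v)) (allV k))))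

  dist-to : ∀ u v → dist k (to u) (to v) ≡ dist k u v
  dist-to u v = least-cong (length (allV k)) (λ m → reach-to m u v)

  count-to : ∀ f → count f (allV k) ≡ count (f ∘ to) (allV k)
  count-to f = trans (sym (↭-length (filter-↭ (T? ∘ f) permutation))) (count-map f to (allV k))
    where
      permutation : map to (allV k) ↭ allV k
      permutation = ∼bag⇒↭ (unique∧set⇒bag (Uniqueₚ.map⁺ to-injective (allV-unique k)) (allV-unique k)
        (λ {v} → mk⇔ (λ _ → ∈-allV v) (λ _ → subst (_∈ map to (allV k)) (to-from v) (∈-map⁺ to (∈-allV (from v))))))

  opaque
    unfolding distanceCount

    distanceCount-to : ∀ Q u v → distanceCount k Q (to u) (to v) ≡ distanceCount k Q u v
    distanceCount-to Q u v = trans (count-to (λ w → Q (dist k (to u) w) (dist k (to v) w)))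
      (count-cong (allV k) (λ w → cong₂ Q (dist-to u w) (dist-to v w)))

identityᴬ : ∀ {k} → Automorphism k
identityᴬ = record { to = id ; from = id ; to-from = λ _ → refl ; from-to = λ _ → refl ; adj-to = λ _ _ → refl }

_∘ᴬ_ : ∀ {k} → Automorphism k → Automorphism k → Automorphism k
_∘ᴬ_ {k} α β = record
  { to = A.to ∘ B.to
  ; from = B.from ∘ A.from
  ; to-from = λ v → trans (cong A.to (B.to-from (A.from v))) (A.to-from v)
  ; from-to = λ v → trans (cong B.from (A.from-to (B.to v))) (B.from-to v)
  ; adj-to = λ u v → trans (A.adj-to (B.to u) (B.to v)) (B.adj-to u v)
  }
  where
    module A = Automorphism α
    module B = Automorphism β

_^ᴬ_ : ∀ {k} → Automorphism k → ℕ → Automorphism k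
α ^ᴬ zero = identityᴬ
α ^ᴬ suc t = (α ^ᴬ t) ∘ᴬ α

-- The rotation of Γ^(k)

module Cyclic (N′ : ℕ) where

  N : ℕ
  N = suc N′

  toℕ-mod : ∀ m → toℕ (m mod N) ≡ m % N
  toℕ-mod m = Finₚ.toℕ-fromℕ< (m%n<n m N)

  ≡-mod⇔ : ∀ (a : Fin N) m → a ≡ m mod N ⇔ toℕ a ≡ m % N
  ≡-mod⇔ a m = mk⇔ (λ { refl → toℕ-mod m }) (λ e → Finₚ.toℕ-injective (trans e (sym (toℕ-mod m))))

  toℕ%N : ∀ (a : Fin N) → toℕ a % N ≡ toℕ a
  toℕ%N a = m<n⇒m%n≡m (Finₚ.toℕ<n a)

  mod-toℕ : ∀ (a : Fin N) → toℕ a mod N ≡ a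
  mod-toℕ a = sym (Equivalence.from (≡-mod⇔ a (toℕ a)) (sym (toℕ%N a)))

  mod-cong : ∀ m m′ → m % N ≡ m′ % N → m mod N ≡ m′ mod N
  mod-cong m m′ e = Finₚ.toℕ-injective (trans (toℕ-mod m) (trans e (sym (toℕ-mod m′))))

  %-absorbˡ : ∀ a b → (a % N + b) % N ≡ (a + b) % N
  %-absorbˡ a b = begin
    (a % N + b) % N            ≡⟨ %-distribˡ-+ (a % N) b N ⟩
    (a % N % N + b % N) % N    ≡⟨ cong (λ r → (r + b % N) % N) (m%n%n≡m%n a N) ⟩
    (a % N + b % N) % N        ≡⟨ %-distribˡ-+ a b N ⟨
    (a + b) % N                ∎
    where open ≡-Reasoning

  %-+1+N′ : ∀ a → (a + 1 + N′) % N ≡ a % N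
  %-+1+N′ a = trans (cong (_% N) (+-assoc a 1 N′)) ([m+n]%n≡m%n a N)

  %-cancel-+1 : ∀ a b → (a + 1) % N ≡ (b + 1) % N → a % N ≡ b % N
  %-cancel-+1 a b e = begin
    a % N                  ≡⟨ %-+1+N′ a ⟨
    (a + 1 + N′) % N       ≡⟨ %-absorbˡ (a + 1) N′ ⟨
    ((a + 1) % N + N′) % N ≡⟨ cong (λ r → (r + N′) % N) e ⟩
    ((b + 1) % N + N′) % N ≡⟨ %-absorbˡ (b + 1) N′ ⟩
    (b + 1 + N′) % N       ≡⟨ %-+1+N′ b ⟩
    b % N                  ∎
    where open ≡-Reasoning

  next : Fin N → Fin N
  next a = (toℕ a + 1) mod N

  prev : Fin N → Fin N
  prev a = (toℕ a + N′) mod N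

  next-prev : ∀ a → next (prev a) ≡ a
  next-prev a = trans (mod-cong (toℕ (prev a) + 1) (toℕ a) (begin
    (toℕ (prev a) + 1) % N ≡⟨ cong (λ r → (r + 1) % N) (toℕ-mod (toℕ a + N′)) ⟩
    ((toℕ a + N′) % N + 1) % N ≡⟨ %-absorbˡ (toℕ a + N′) 1 ⟩
    (toℕ a + N′ + 1) % N ≡⟨ cong (_% N) (trans (+-assoc (toℕ a) N′ 1) (cong (toℕ a +_) (+-comm N′ 1))) ⟩
    (toℕ a + N) % N ≡⟨ [m+n]%n≡m%n (toℕ a) N ⟩
    toℕ a % N ∎)) (mod-toℕ a)
    where open ≡-Reasoning

  prev-next : ∀ a → prev (next a) ≡ a
  prev-next a = trans (mod-cong (toℕ (next a) + N′) (toℕ a) (begin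
    (toℕ (next a) + N′) % N ≡⟨ cong (λ r → (r + N′) % N) (toℕ-mod (toℕ a + 1)) ⟩
    ((toℕ a + 1) % N + N′) % N ≡⟨ %-absorbˡ (toℕ a + 1) N′ ⟩
    (toℕ a + 1 + N′) % N ≡⟨ %-+1+N′ (toℕ a) ⟩
    toℕ a % N ∎)) (mod-toℕ a)
    where open ≡-Reasoning

  eqF-next : ∀ a c d → (c + 1) % N ≡ d % N → eqF (next a) (d mod N) ≡ eqF a (c mod N)
  eqF-next a c d c+1≡d = T-ext
    (λ t → Equivalence.from eqF⇔≡ (Equivalence.from (≡-mod⇔ a c) (trans (sym (toℕ%N a)) (%-cancel-+1 (toℕ a) c
      (trans (sym (toℕ-mod (toℕ a + 1))) (trans (Equivalence.to (≡-mod⇔ _ d) (Equivalence.to eqF⇔≡ t)) (sym c+1≡d)))))))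
    (λ t → Equivalence.from eqF⇔≡ (Equivalence.from (≡-mod⇔ (next a) d) (begin
      toℕ (next a)       ≡⟨ toℕ-mod (toℕ a + 1) ⟩
      (toℕ a + 1) % N    ≡⟨ cong (λ r → (r + 1) % N) (Equivalence.to (≡-mod⇔ a c) (Equivalence.to eqF⇔≡ t)) ⟩
      (c % N + 1) % N    ≡⟨ %-absorbˡ c 1 ⟩
      (c + 1) % N        ≡⟨ c+1≡d ⟩
      d % N              ∎)))
    where open ≡-Reasoning

+-right-comm : ∀ a b c → a + b + c ≡ a + c + b
+-right-comm a b c = trans (+-assoc a b c) (trans (cong (a +_) (+-comm b c)) (sym (+-assoc a c b)))

∨-split₃ : ∀ a b c r → a ∨ b ∨ c ∨ r ≡ (a ∨ b ∨ c ∨ false) ∨ r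
∨-split₃ true  b     c     r = refl
∨-split₃ false true  c     r = refl
∨-split₃ false false true  r = refl
∨-split₃ false false false r = refl

∨-rotate₃ : ∀ a b c d e f → d ∨ e ∨ f ∨ a ∨ b ∨ c ∨ false ≡ a ∨ b ∨ c ∨ d ∨ e ∨ f ∨ false
∨-rotate₃ a b c d e f = begin
  d ∨ e ∨ f ∨ (a ∨ b ∨ c ∨ false)           ≡⟨ ∨-split₃ d e f _ ⟩
  (d ∨ e ∨ f ∨ false) ∨ (a ∨ b ∨ c ∨ false) ≡⟨ ∨-comm (d ∨ e ∨ f ∨ false) _ ⟩
  (a ∨ b ∨ c ∨ false) ∨ (d ∨ e ∨ f ∨ false) ≡⟨ ∨-split₃ a b c _ ⟨
  a ∨ b ∨ c ∨ (d ∨ e ∨ f ∨ false)           ∎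
  where open ≡-Reasoning

module Rotation (k : ℕ) (1≤k : 1 ≤ k) where

  module X = Cyclic (3 + 8 * k)
  module Y = Cyclic (1 + 4 * k)

  rotate : V k → V k
  rotate (x a) = x (X.next a)
  rotate (y i) = y (Y.next i)

  unrotate : V k → V k
  unrotate (x a) = x (X.prev a)
  unrotate (y i) = y (Y.prev i)

  adjXX-rotate : ∀ a b → adjXX k (X.next a) (X.next b) ≡ adjXX k a b
  adjXX-rotate a b = cong₂ _∨_ (step a b) (step b a)
    where
      step : ∀ a b → eqF (X.next b) ((toℕ (X.next a) + 1) mod NX k) ≡ eqF b ((toℕ a + 1) mod NX k)
      step a b = X.eqF-next b (toℕ a + 1) (toℕ (X.next a) + 1)
        (sym (trans (cong (λ r → (r + 1) % NX k) (X.toℕ-mod (toℕ a + 1))) (X.%-absorbˡ (toℕ a + 1) 1)))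

  2k∸1+1≡2k : 2 * k ∸ 1 + 1 ≡ 2 * k
  2k∸1+1≡2k = m∸n+n≡m (≤-trans 1≤k (m≤m+n k (k + 0)))

  adjYX-rotate : ∀ i a → adjYX k (Y.next i) (X.next a) ≡ adjYX k i a
  adjYX-rotate i a with m≤n⇒m<n∨m≡n (Finₚ.toℕ<n i)
  ... | inj₁ i+1<NY = cong or (map-cong term (offsets k))
    where
      next-i : toℕ (Y.next i) ≡ toℕ i + 1
      next-i = trans (Y.toℕ-mod (toℕ i + 1)) (m<n⇒m%n≡m (subst (_< NY k) (+-comm 1 (toℕ i)) i+1<NY))
      term : ∀ m → eqF (X.next a) ((toℕ (Y.next i) + m) mod NX k) ≡ eqF a ((toℕ i + m) mod NX k)
      term m = X.eqF-next a (toℕ i + m) (toℕ (Y.next i) + m)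
        (cong (_% NX k) (trans (+-right-comm (toℕ i) m 1) (cong (_+ m) (sym next-i))))
  -- y_{4k+1} wraps around to y₀ while x still advances by one; the offsets are invariant under
  -- +4k+2 modulo 8k+4, so the six tests are merely permuted.
  ... | inj₂ i+1≡NY = trans
      (cong₂ _∨_ (term 0 (4 * k + 2) (inj₁ w₀)) (cong₂ _∨_ (term (2 * k ∸ 1) (6 * k + 1) (inj₁ w₁))
      (cong₂ _∨_ (term (2 * k + 1) (6 * k + 3) (inj₁ w₂)) (cong₂ _∨_ (term (4 * k + 2) 0 (inj₂ w₃))
      (cong₂ _∨_ (term (6 * k + 1) (2 * k ∸ 1) (inj₂ w₄)) (cong₂ _∨_ (term (6 * k + 3) (2 * k + 1) (inj₂ w₅)) refl))))))
      (∨-rotate₃ (B 0) (B (2 * k ∸ 1)) (B (2 * k + 1)) (B (4 * k + 2)) (B (6 * k + 1)) (B (6 * k + 3)))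
    where
      B : ℕ → Bool
      B m = eqF a ((toℕ i + m) mod NX k)
      next-i : toℕ (Y.next i) ≡ 0
      next-i = trans (Y.toℕ-mod (toℕ i + 1)) (trans (cong (_% NY k) (trans (+-comm (toℕ i) 1) i+1≡NY)) (n%n≡0 (NY k)))
      term : ∀ m m′ → NY k + m′ ≡ m + NX k ⊎ NY k + m′ ≡ m → eqF (X.next a) ((toℕ (Y.next i) + m) mod NX k) ≡ B m′
      term m m′ wrap = X.eqF-next a (toℕ i + m′) (toℕ (Y.next i) + m) (begin
        (toℕ i + m′ + 1) % NX k     ≡⟨ cong (_% NX k) (trans (+-right-comm (toℕ i) m′ 1)
                                                         (cong (_+ m′) (trans (+-comm (toℕ i) 1) i+1≡NY))) ⟩
        (NY k + m′) % NX k          ≡⟨ reduce wrap ⟩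
        m % NX k                    ≡⟨ cong (λ r → (r + m) % NX k) next-i ⟨
        (toℕ (Y.next i) + m) % NX k ∎)
        where
          open ≡-Reasoning
          reduce : NY k + m′ ≡ m + NX k ⊎ NY k + m′ ≡ m → (NY k + m′) % NX k ≡ m % NX k
          reduce (inj₁ e) = trans (cong (_% NX k) e) ([m+n]%n≡m%n m (NX k))
          reduce (inj₂ e) = cong (_% NX k) e
      w₀ : NY k + (4 * k + 2) ≡ 0 + NX k
      w₀ = lemma k where
        lemma : ∀ k → 2 + 4 * k + (4 * k + 2) ≡ 0 + (4 + 8 * k)
        lemma = solve-∀
      w₁ : NY k + (6 * k + 1) ≡ (2 * k ∸ 1) + NX k
      w₁ = +-cancelʳ-≡ 1 _ _ (trans (lemma k) (trans (cong (_+ NX k) (sym 2k∸1+1≡2k)) (+-right-comm (2 * k ∸ 1) 1 (NX k))))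
        where
          lemma : ∀ k → 2 + 4 * k + (6 * k + 1) + 1 ≡ 2 * k + (4 + 8 * k)
          lemma = solve-∀
      w₂ : NY k + (6 * k + 3) ≡ (2 * k + 1) + NX k
      w₂ = lemma k where
        lemma : ∀ k → 2 + 4 * k + (6 * k + 3) ≡ (2 * k + 1) + (4 + 8 * k)
        lemma = solve-∀
      w₃ : NY k + 0 ≡ 4 * k + 2
      w₃ = lemma k where
        lemma : ∀ k → 2 + 4 * k + 0 ≡ 4 * k + 2
        lemma = solve-∀
      w₄ : NY k + (2 * k ∸ 1) ≡ 6 * k + 1
      w₄ = +-cancelʳ-≡ 1 _ _ (trans (+-assoc (NY k) (2 * k ∸ 1) 1) (trans (cong (NY k +_) 2k∸1+1≡2k) (lemma k)))
        where
          lemma : ∀ k → 2 + 4 * k + 2 * k ≡ 6 * k + 1 + 1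
          lemma = solve-∀
      w₅ : NY k + (2 * k + 1) ≡ 6 * k + 3
      w₅ = lemma k where
        lemma : ∀ k → 2 + 4 * k + (2 * k + 1) ≡ 6 * k + 3
        lemma = solve-∀

  adj-rotate : ∀ u v → adj k (rotate u) (rotate v) ≡ adj k u v
  adj-rotate (x a) (x b) = adjXX-rotate a b
  adj-rotate (x a) (y i) = adjYX-rotate i a
  adj-rotate (y i) (x a) = adjYX-rotate i a
  adj-rotate (y i) (y j) = refl

  rotation : Automorphism k
  rotation = record
    { to = rotate
    ; from = unrotate
    ; to-from = λ { (x a) → cong x (X.next-prev a) ; (y i) → cong y (Y.next-prev i) }
    ; from-to = λ { (x a) → cong x (X.prev-next a) ; (y i) → cong y (Y.prev-next i) }
    ; adj-to = adj-rotate
    }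

  rotation^-x : ∀ t a → Automorphism.to (rotation ^ᴬ t) (x (a mod NX k)) ≡ x ((a + t) mod NX k)
  rotation^-x zero a = cong (λ r → x (r mod NX k)) (sym (+-identityʳ a))
  rotation^-x (suc t) a = begin
    ρ (x (X.next (a mod NX k))) ≡⟨ cong (ρ ∘ x) next-mod ⟩
    ρ (x ((a + 1) mod NX k))    ≡⟨ rotation^-x t (a + 1) ⟩
    x ((a + 1 + t) mod NX k)    ≡⟨ cong (λ r → x (r mod NX k)) (+-assoc a 1 t) ⟩
    x ((a + suc t) mod NX k)    ∎
    where
      open ≡-Reasoning
      ρ : V k → V k
      ρ = Automorphism.to (rotation ^ᴬ t)
      next-mod : X.next (a mod NX k) ≡ (a + 1) mod NX k
      next-mod = X.mod-cong (toℕ (a mod NX k) + 1) (a + 1) (trans (cong (λ r → (r + 1) % NX k) (X.toℕ-mod a)) (X.%-absorbˡ a 1))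

-- Counting along ranges and the distance profile

≡ᵇ-refl : ∀ m → (m ≡ᵇ m) ≡ true
≡ᵇ-refl m with m ≡ᵇ m | ≡⇒≡ᵇ m m refl
... | true | _ = refl

≡ᵇ-≢ : ∀ {m n} → m ≢ n → (m ≡ᵇ n) ≡ false
≡ᵇ-≢ {m} {n} m≢n with m ≡ᵇ n | ≡ᵇ⇒≡ m n
... | false | _ = refl
... | true  | ≡⇒ = ⊥-elim (m≢n (≡⇒ tt))

[_] : Bool → ℕ
[ true ] = 1
[ false ] = 0

count< : ℕ → (ℕ → Bool) → ℕ
count< zero f = 0
count< (suc l) f = [ f 0 ] + count< l (f ∘ suc)

count<-+ : ∀ a b f → count< (a + b) f ≡ count< a f + count< b (λ i → f (a + i))
count<-+ zero b f = refl
count<-+ (suc a) b f = trans (cong ([ f 0 ] +_) (count<-+ a b (f ∘ suc))) (sym (+-assoc [ f 0 ] _ _))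

count<-cong : ∀ l {f g} → (∀ i → i < l → f i ≡ g i) → count< l f ≡ count< l g
count<-cong zero f≗g = refl
count<-cong (suc l) f≗g = cong₂ _+_ (cong [_] (f≗g 0 z<s)) (count<-cong l (λ i i<l → f≗g (suc i) (s<s i<l)))

count<-const : ∀ l b → count< l (λ _ → b) ≡ l * [ b ]
count<-const zero b = refl
count<-const (suc l) b = cong ([ b ] +_) (count<-const l b)

count<-last : ∀ l f → count< (suc l) f ≡ count< l f + [ f l ]
count<-last l f = trans (cong (λ m → count< m f) (+-comm 1 l))
  (trans (count<-+ l 1 f) (cong (count< l f +_) (trans (+-identityʳ _) (cong (λ i → [ f i ]) (+-identityʳ l)))))

count<-reverse : ∀ l f → count< l f ≡ count< l (λ i → f (l ∸ suc i))
count<-reverse zero f = refl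
count<-reverse (suc l) f = begin
  [ f 0 ] + count< l (f ∘ suc)                         ≡⟨ cong ([ f 0 ] +_) (count<-reverse l (f ∘ suc)) ⟩
  [ f 0 ] + count< l (λ i → f (suc (l ∸ suc i)))       ≡⟨ +-comm [ f 0 ] _ ⟩
  count< l (λ i → f (suc (l ∸ suc i))) + [ f 0 ]
    ≡⟨ cong₂ _+_ (count<-cong l (λ i i<l → cong f (sym (+-∸-assoc 1 i<l)))) (cong (λ i → [ f i ]) (sym (n∸n≡0 l))) ⟩
  count< l (λ i → f (suc l ∸ suc i)) + [ f (suc l ∸ suc l) ] ≡⟨ count<-last l (λ i → f (suc l ∸ suc i)) ⟨
  count< (suc l) (λ i → f (suc l ∸ suc i))            ∎
  where open ≡-Reasoning

count<-reversed : ∀ l {f g} → (∀ i t → t + suc i ≡ l → f t ≡ g i) → count< l f ≡ count< l g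
count<-reversed l {f} f≗g = trans (count<-reverse l f) (count<-cong l (λ i i<l → f≗g i (l ∸ suc i) (m∸n+n≡m i<l)))

count-tabulate : ∀ {A : Set} (f : A → Bool) m (ι : Fin m → A) (g : ℕ → Bool) →
  (∀ i → f (ι i) ≡ g (toℕ i)) → count f (tabulate ι) ≡ count< m g
count-tabulate f zero ι g f≗g = refl
count-tabulate f (suc m) ι g f≗g with f (ι fzero) | g 0 | f≗g fzero
... | true  | true  | refl = cong suc (count-tabulate f m (ι ∘ fsuc) (g ∘ suc) (f≗g ∘ fsuc))
... | false | false | refl = count-tabulate f m (ι ∘ fsuc) (g ∘ suc) (f≗g ∘ fsuc)

ascents descents : (ℕ → ℕ → Bool) → ℕ → ℕ → ℕ
ascents Q c l = count< l (λ j → Q (c + suc j) (c + j))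
descents Q c l = count< l (λ j → Q (c + j) (c + suc j))

at : ℕ → ℕ → ℕ → ℕ → Bool
at a b u v = (u ≡ᵇ a) ∧ (v ≡ᵇ b)

count<-none : ∀ l {f} → (∀ i → i < l → f i ≡ false) → count< l f ≡ 0
count<-none l none = trans (count<-cong l none) (trans (count<-const l false) (*-zeroʳ l))

count<-unique : ∀ t l → t < l → count< l (λ j → j ≡ᵇ t) ≡ 1
count<-unique zero (suc l) _ = cong suc (count<-none l (λ _ _ → refl))
count<-unique (suc t) (suc l) (s<s t<l) = count<-unique t l t<l

count<-hit : ∀ c t l → t < l → count< l (λ j → c + j ≡ᵇ c + t) ≡ 1
count<-hit c t l t<l = trans (count<-cong l (λ j _ → cancel c j)) (count<-unique t l t<l)
  where
    cancel : ∀ c j → (c + j ≡ᵇ c + t) ≡ (j ≡ᵇ t)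
    cancel zero j = refl
    cancel (suc c) j = cancel c j

count<-below : ∀ c b l → b < c → count< l (λ j → c + j ≡ᵇ b) ≡ 0
count<-below c b l b<c = count<-none l (λ j _ → ≡ᵇ-≢ (λ c+j≡b → <⇒≱ b<c (subst (c ≤_) c+j≡b (m≤m+n c j))))

ascents-at : ∀ b c l → ascents (at (suc b) b) c l ≡ count< l (λ j → c + j ≡ᵇ b)
ascents-at b c l = count<-cong l (λ j _ → trans (cong (λ u → (u ≡ᵇ suc b) ∧ (c + j ≡ᵇ b)) (+-suc c j)) (∧-idem _))

ascents-at-≢ : ∀ a b c l → a ≢ suc b → ascents (at a b) c l ≡ 0
ascents-at-≢ a b c l a≢1+b = count<-none l step
  where
    step : ∀ j → j < l → at a b (c + suc j) (c + j) ≡ false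
    step j _ with c + j ≡ᵇ b | ≡ᵇ⇒≡ (c + j) b
    ... | false | _ = ∧-zeroʳ _
    ... | true  | ≡⇒ = cong (_∧ true) (≡ᵇ-≢ (λ eq → a≢1+b (trans (sym eq) (trans (+-suc c j) (cong suc (≡⇒ tt))))))

descents-at-≢ : ∀ a b c l → b ≢ suc a → descents (at a b) c l ≡ 0
descents-at-≢ a b c l b≢1+a = count<-none l step
  where
    step : ∀ j → j < l → at a b (c + j) (c + suc j) ≡ false
    step j _ with c + j ≡ᵇ a | ≡ᵇ⇒≡ (c + j) a
    ... | false | _ = refl
    ... | true  | ≡⇒ = ≡ᵇ-≢ (λ eq → b≢1+a (trans (sym eq) (trans (+-suc c j) (cong suc (≡⇒ tt)))))

steps-split : ∀ m l (Q : ℕ → ℕ → Bool) (f g h : ℕ → ℕ) →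
  (∀ s → s ≤ m → f s ≡ g s) →
  (∀ s d → s + d ≡ m + suc (suc l) → d ≤ suc l → f s ≡ h d) →
  count< (m + suc l) (λ s → Q (f (suc s)) (f s))
    ≡ count< m (λ s → Q (g (suc s)) (g s)) + ([ Q (h (suc l)) (g m) ] + count< l (λ t → Q (h (suc t)) (h (suc (suc t)))))
steps-split m l Q f g h near far = begin
  count< (m + suc l) F                                 ≡⟨ count<-+ m (suc l) F ⟩
  count< m F + ([ F (m + 0) ] + count< l (λ t → F (m + suc t)))
    ≡⟨ cong₂ _+_ (count<-cong m (λ s s<m → cong₂ Q (near (suc s) s<m) (near s (<⇒≤ s<m))))
                 (cong₂ _+_ (cong [_] (cong₂ Q middle corner))
                            (count<-reversed l (λ i t e → cong₂ Q (far-left t i e) (far-right t i e)))) ⟩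
  count< m (λ s → Q (g (suc s)) (g s)) + ([ Q (h (suc l)) (g m) ] + count< l (λ t → Q (h (suc t)) (h (suc (suc t))))) ∎
  where
    open ≡-Reasoning
    F : ℕ → Bool
    F s = Q (f (suc s)) (f s)
    middle : f (suc (m + 0)) ≡ h (suc l)
    middle = far (suc (m + 0)) (suc l) (trans (cong (λ r → suc r + suc l) (+-identityʳ m)) (sym (+-suc m (suc l)))) ≤-refl
    corner : f (m + 0) ≡ g m
    corner = trans (near (m + 0) (≤-reflexive (+-identityʳ m))) (cong g (+-identityʳ m))
    1+i≤l : ∀ t i → t + suc i ≡ l → suc i ≤ l
    1+i≤l t i e = ≤-by t (trans (+-comm (suc i) t) e)
    far-left : ∀ t i → t + suc i ≡ l → f (suc (m + suc t)) ≡ h (suc i)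
    far-left t i e =
      far (suc (m + suc t)) (suc i) (trans (lemma m t i) (cong (λ r → m + suc (suc r)) e)) (s≤s (<⇒≤ (1+i≤l t i e)))
      where lemma : ∀ m t i → suc (m + suc t) + suc i ≡ m + suc (suc (t + suc i))
            lemma = solve-∀
    far-right : ∀ t i → t + suc i ≡ l → f (m + suc t) ≡ h (suc (suc i))
    far-right t i e =
      far (m + suc t) (suc (suc i)) (trans (lemma m t i) (cong (λ r → m + suc (suc r)) e)) (s≤s (1+i≤l t i e))
      where lemma : ∀ m t i → m + suc t + suc (suc i) ≡ m + suc (suc (t + suc i))
            lemma = solve-∀

nearPairs : (ℕ → ℕ → Bool) → ℕ
nearPairs Q = [ Q 0 1 ] + [ Q 1 0 ] + 4 * ([ Q 1 2 ] + [ Q 2 1 ]) + 12 * ([ Q 2 3 ] + [ Q 3 2 ]) + ([ Q 3 4 ] + [ Q 4 3 ])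

farPairs : ℕ → (ℕ → ℕ → Bool) → ℕ
farPairs k Q = ascents Q 3 (k ∸ 3) + descents Q 3 (k ∸ 3) + [ Q k k ]

profile : ℕ → (ℕ → ℕ → Bool) → ℕ
profile k Q = nearPairs Q + 6 * farPairs k Q

profile-flip : ∀ k Q → profile k (flip Q) ≡ profile k Q
profile-flip k Q = cong₂ (λ a b → a + 6 * b)
  (swap-near [ Q 0 1 ] [ Q 1 0 ] [ Q 1 2 ] [ Q 2 1 ] [ Q 2 3 ] [ Q 3 2 ] [ Q 3 4 ] [ Q 4 3 ])
  (cong (_+ [ Q k k ]) (+-comm (descents Q 3 (k ∸ 3)) (ascents Q 3 (k ∸ 3))))
  where
    swap-near : ∀ a b c d e f g h → b + a + 4 * (d + c) + 12 * (f + e) + (h + g) ≡ a + b + 4 * (c + d) + 12 * (e + f) + (g + h)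
    swap-near = solve-∀

profile-cong : ∀ k {Q Q′ : ℕ → ℕ → Bool} → (∀ u v → Q u v ≡ Q′ u v) → profile k Q ≡ profile k Q′
profile-cong k {Q} {Q′} Q≗Q′ = cong₂ (λ a b → a + 6 * b) near far
  where
    [Q≗Q′] : ∀ u v → [ Q u v ] ≡ [ Q′ u v ]
    [Q≗Q′] u v = cong [_] (Q≗Q′ u v)
    near : nearPairs Q ≡ nearPairs Q′
    near = cong₂ _+_ (cong₂ _+_ (cong₂ _+_ (cong₂ _+_ ([Q≗Q′] 0 1) ([Q≗Q′] 1 0))
                                            (cong (4 *_) (cong₂ _+_ ([Q≗Q′] 1 2) ([Q≗Q′] 2 1))))
                                 (cong (12 *_) (cong₂ _+_ ([Q≗Q′] 2 3) ([Q≗Q′] 3 2))))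
                     (cong₂ _+_ ([Q≗Q′] 3 4) ([Q≗Q′] 4 3))
    far : farPairs k Q ≡ farPairs k Q′
    far = cong₂ _+_ (cong₂ _+_ (count<-cong (k ∸ 3) (λ _ _ → Q≗Q′ _ _)) (count<-cong (k ∸ 3) (λ _ _ → Q≗Q′ _ _)))
                    ([Q≗Q′] k k)

profile-at-swap : ∀ k a b → profile k (at b a) ≡ profile k (at a b)
profile-at-swap k a b = trans (profile-cong k (λ u v → ∧-comm (u ≡ᵇ b) (v ≡ᵇ a))) (profile-flip k (at a b))

at-diagonal : ∀ {a b} u → a ≢ b → at a b u u ≡ false
at-diagonal {a} {b} u a≢b with u ≡ᵇ a | ≡ᵇ⇒≡ u a
... | false | _ = refl
... | true  | ≡⇒ = ≡ᵇ-≢ (λ u≡b → a≢b (trans (sym (≡⇒ tt)) u≡b))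

at-off-diagonal : ∀ i {u v} → u ≢ v → at i i u v ≡ false
at-off-diagonal i {u} {v} u≢v with u ≡ᵇ i | ≡ᵇ⇒≡ u i
... | false | _ = refl
... | true  | ≡⇒ = ≡ᵇ-≢ (λ v≡i → u≢v (trans (≡⇒ tt) (sym v≡i)))

n≢1+n : ∀ n → n ≢ suc n
n≢1+n n = <⇒≢ (n<1+n n)

farPairs-ascent : ∀ k b → 3 ≤ b → b < k → farPairs k (at (suc b) b) ≡ 1
farPairs-ascent k b 3≤b b<k = cong₂ _+_
  (cong₂ _+_ ascent (descents-at-≢ (suc b) b 3 (k ∸ 3) (<⇒≢ (m<n⇒m<1+n (n<1+n b)))))
  (cong [_] (at-diagonal k (n≢1+n b ∘ sym)))
  where
    ascent : ascents (at (suc b) b) 3 (k ∸ 3) ≡ 1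
    ascent = trans (ascents-at b 3 (k ∸ 3))
      (subst (λ b′ → count< (k ∸ 3) (λ j → 3 + j ≡ᵇ b′) ≡ 1) (m+[n∸m]≡n 3≤b) (count<-hit 3 (b ∸ 3) (k ∸ 3) (∸-monoˡ-< b<k 3≤b)))

farPairs-low-ascent : ∀ k b → b < 3 → farPairs k (at (suc b) b) ≡ 0
farPairs-low-ascent k b b<3 = cong₂ _+_
  (cong₂ _+_ (trans (ascents-at b 3 (k ∸ 3)) (count<-below 3 b (k ∸ 3) b<3))
             (descents-at-≢ (suc b) b 3 (k ∸ 3) (<⇒≢ (m<n⇒m<1+n (n<1+n b)))))
  (cong [_] (at-diagonal k (n≢1+n b ∘ sym)))

farPairs-diagonal : ∀ k i → i < k → farPairs k (at i i) ≡ 0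
farPairs-diagonal k i i<k = cong₂ _+_
  (cong₂ _+_ (ascents-at-≢ i i 3 (k ∸ 3) (n≢1+n i)) (descents-at-≢ i i 3 (k ∸ 3) (n≢1+n i)))
  (cong (λ b → [ b ∧ b ]) (≡ᵇ-≢ (<⇒≢ i<k ∘ sym)))

farPairs-top : ∀ k → farPairs k (at k k) ≡ 1
farPairs-top k = cong₂ _+_
  (cong₂ _+_ (ascents-at-≢ k k 3 (k ∸ 3) (n≢1+n k)) (descents-at-≢ k k 3 (k ∸ 3) (n≢1+n k)))
  (cong (λ b → [ b ∧ b ]) (≡ᵇ-refl k))

nearPairs-diagonal : ∀ i → nearPairs (at i i) ≡ 0
nearPairs-diagonal i =
  cong₂ _+_ (cong₂ _+_ (cong₂ _+_ (cong₂ _+_ (off 0 1 (λ ())) (off 1 0 (λ ())))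
    (cong (4 *_) (cong₂ _+_ (off 1 2 (λ ())) (off 2 1 (λ ()))))) (cong (12 *_) (cong₂ _+_ (off 2 3 (λ ())) (off 3 2 (λ ())))))
    (cong₂ _+_ (off 3 4 (λ ())) (off 4 3 (λ ())))
  where
    off : ∀ u v → u ≢ v → [ at i i u v ] ≡ 0
    off u v u≢v = cong [_] (at-off-diagonal i u≢v)

-- Distances from x₀

if-≤ : ∀ {A : Set} {m n} {a b : A} → m ≤ n → (if m ≤ᵇ n then a else b) ≡ a
if-≤ {m = m} {n} m≤n with m ≤ᵇ n | ≤⇒≤ᵇ m≤n
... | true | _ = refl

if-> : ∀ {A : Set} {m n} {a b : A} → n < m → (if m ≤ᵇ n then a else b) ≡ b
if-> {m = m} {n} n<m with m ≤ᵇ n | ≤ᵇ⇒≤ m n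
... | false | _ = refl
... | true  | ≤⇒ = ⊥-elim (<⇒≱ n<m (≤⇒ tt))

if-< : ∀ {A : Set} {m n} {a b : A} → m < n → (if m <ᵇ n then a else b) ≡ a
if-< {m = m} {n} m<n with m <ᵇ n | <⇒<ᵇ m<n
... | true | _ = refl

if-≥ : ∀ {A : Set} {m n} {a b : A} → n ≤ m → (if m <ᵇ n then a else b) ≡ b
if-≥ {m = m} {n} n≤m with m <ᵇ n | <ᵇ⇒< m n
... | false | _ = refl
... | true  | <⇒ = ⊥-elim (<⇒≱ (<⇒ tt) n≤m)

Near : ℕ → ℕ → Set
Near a b = a ≤ suc b × b ≤ suc a

near-refl : ∀ a → Near a a
near-refl a = n≤1+n a , n≤1+n a

near-suc : ∀ a → Near a (suc a)
near-suc a = m≤n⇒m≤1+n (n≤1+n a) , ≤-refl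

near-pred : ∀ a → Near (suc a) a
near-pred a = ≤-refl , m≤n⇒m≤1+n (n≤1+n a)

near-sym : ∀ {a b} → Near a b → Near b a
near-sym (a≤ , b≤) = b≤ , a≤

near-subst : ∀ {a b a′ b′} → a ≡ a′ → b ≡ b′ → Near a′ b′ → Near a b
near-subst refl refl near = near

detour : ℕ → ℕ
detour 0 = 2
detour 1 = 3
detour (suc (suc d)) = suc (suc d)

near-detour-suc : ∀ d → Near (detour d) (detour (suc d))
near-detour-suc 0 = near-suc 2
near-detour-suc 1 = near-pred 2
near-detour-suc (suc (suc d)) = near-suc _

near-suc-detour : ∀ d → 1 ≤ d → Near (suc d) (detour d)
near-suc-detour 1 _ = near-suc 2
near-suc-detour (suc (suc d)) _ = near-pred _

detour≢0 : ∀ d → detour d ≢ 0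
detour≢0 0 ()
detour≢0 1 ()
detour≢0 (suc (suc d)) ()

detour-≤ : ∀ {k} d → 3 ≤ k → d ≤ k → detour d ≤ k
detour-≤ 0 3≤k _ = ≤-trans (n≤1+n 2) 3≤k
detour-≤ 1 3≤k _ = 3≤k
detour-≤ (suc (suc d)) _ d≤k = d≤k

module Distances (K : ℕ) where

  k p n h : ℕ
  k = suc (suc (suc (suc (suc K))))
  p = suc (2 * k)
  n = NX k
  h = NY k

  n≡4p : n ≡ p + p + p + p
  n≡4p = lemma K where
    lemma : ∀ K → 4 + 8 * (5 + K) ≡ suc (2 * (5 + K)) + suc (2 * (5 + K)) + suc (2 * (5 + K)) + suc (2 * (5 + K))
    lemma = solve-∀

  h≡2p : h ≡ p + p
  h≡2p = lemma K where
    lemma : ∀ K → 2 + 4 * (5 + K) ≡ suc (2 * (5 + K)) + suc (2 * (5 + K))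
    lemma = solve-∀

  p≡ : p ≡ suc (k + k)
  p≡ = cong suc (cong (k +_) (+-identityʳ k))

  k<p : k < p
  k<p = s≤s (m≤m+n k (k + 0))

  -- Write x_r with r = q p + s and y_T with T = q p + s, where p = 2k + 1 and s < p.  Then d(x₀, x_r) is
  -- dx₀ s, dx₁ s, dx₁ s, dx₃ s for q = 0, 1, 2, 3, and d(x₀, y_T) is dy₀ s, dy₁ s for q = 0, 1.
  dx₀ dx₁ dx₃ : ℕ → ℕ
  dx₀ s = if s ≤ᵇ k then s else detour (p ∸ s)
  dx₁ s = if s ≤ᵇ k then detour s else detour (p ∸ s)
  dx₃ s = if s ≤ᵇ k then detour s else p ∸ s

  distX : ℕ → ℕ
  distX r =
    if r <ᵇ p then dx₀ r
    else if r <ᵇ p + p then dx₁ (r ∸ p)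
    else if r <ᵇ p + p + p then dx₁ (r ∸ (p + p))
    else dx₃ (r ∸ (p + p + p))

  dyFar : ℕ → ℕ
  dyFar s = if s ≤ᵇ suc k then pred s else suc p ∸ s

  dy₀ dy₁ : ℕ → ℕ
  dy₀ 0 = 1
  dy₀ 1 = 2
  dy₀ 2 = 3
  dy₀ 3 = 4
  dy₀ s@(suc (suc (suc (suc _)))) = dyFar s
  dy₁ 0 = 1
  dy₁ 1 = 2
  dy₁ 2 = 1
  dy₁ s@(suc (suc (suc _))) = dyFar s

  distY : ℕ → ℕ
  distY T = if T <ᵇ p then dy₀ T else dy₁ (T ∸ p)

  distX-q₀ : ∀ s → s < p → distX s ≡ dx₀ s
  distX-q₀ s s<p = if-< s<p

  distX-q₁ : ∀ s → s < p → distX (p + s) ≡ dx₁ s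
  distX-q₁ s s<p = trans (if-≥ (m≤m+n p s)) (trans (if-< (+-monoʳ-< p s<p)) (cong dx₁ (m+n∸m≡n p s)))

  distX-q₂ : ∀ s → s < p → distX (p + p + s) ≡ dx₁ s
  distX-q₂ s s<p = trans (if-≥ (≤-trans (m≤m+n p p) (m≤m+n (p + p) s)))
    (trans (if-≥ (m≤m+n (p + p) s)) (trans (if-< (+-monoʳ-< (p + p) s<p)) (cong dx₁ (m+n∸m≡n (p + p) s))))

  distX-q₃ : ∀ s → s < p → distX (p + p + p + s) ≡ dx₃ s
  distX-q₃ s s<p = trans (if-≥ (≤-trans (≤-trans (m≤m+n p p) (m≤m+n (p + p) p)) (m≤m+n (p + p + p) s)))
    (trans (if-≥ (≤-trans (m≤m+n (p + p) p) (m≤m+n (p + p + p) s)))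
    (trans (if-≥ (m≤m+n (p + p + p) s)) (cong dx₃ (m+n∸m≡n (p + p + p) s))))

  distY-q₀ : ∀ s → s < p → distY s ≡ dy₀ s
  distY-q₀ s s<p = if-< s<p

  distY-q₁ : ∀ s → distY (p + s) ≡ dy₁ s
  distY-q₁ s = trans (if-≥ (m≤m+n p s)) (cong dy₁ (m+n∸m≡n p s))

  far⇒k<s : ∀ s d → s + d ≡ p → d ≤ k → k < s
  far⇒k<s s d s+d≡p d≤k with k <? s
  ... | yes k<s = k<s
  ... | no k≮s = ⊥-elim (<-irrefl refl (subst (_< suc (k + k)) (trans s+d≡p p≡) (s≤s (+-mono-≤ (≮⇒≥ k≮s) d≤k))))

  far⇒p∸s : ∀ s d → s + d ≡ p → p ∸ s ≡ d
  far⇒p∸s s d s+d≡p = trans (cong (_∸ s) (sym s+d≡p)) (m+n∸m≡n s d)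

  dx₀-near : ∀ s → s ≤ k → dx₀ s ≡ s
  dx₀-near s s≤k = if-≤ s≤k

  dx₁-near : ∀ s → s ≤ k → dx₁ s ≡ detour s
  dx₁-near s s≤k = if-≤ s≤k

  dx₃-near : ∀ s → s ≤ k → dx₃ s ≡ detour s
  dx₃-near s s≤k = if-≤ s≤k

  dx₀-far : ∀ s d → s + d ≡ p → d ≤ k → dx₀ s ≡ detour d
  dx₀-far s d s+d≡p d≤k = trans (if-> (far⇒k<s s d s+d≡p d≤k)) (cong detour (far⇒p∸s s d s+d≡p))

  dx₁-far : ∀ s d → s + d ≡ p → d ≤ k → dx₁ s ≡ detour d
  dx₁-far s d s+d≡p d≤k = trans (if-> (far⇒k<s s d s+d≡p d≤k)) (cong detour (far⇒p∸s s d s+d≡p))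

  dx₃-far : ∀ s d → s + d ≡ p → d ≤ k → dx₃ s ≡ d
  dx₃-far s d s+d≡p d≤k = trans (if-> (far⇒k<s s d s+d≡p d≤k)) (far⇒p∸s s d s+d≡p)

  dyFar-near : ∀ d → d ≤ k → dyFar (suc d) ≡ d
  dyFar-near d d≤k = if-≤ (s≤s d≤k)

  dyFar-far : ∀ s d → s + d ≡ suc p → d ≤ k → dyFar s ≡ d
  dyFar-far zero d d≡1+p d≤k = ⊥-elim (<⇒≱ (subst (k <_) (sym d≡1+p) (≤-trans k<p (n≤1+n p))) d≤k)
  dyFar-far (suc s) d s+d≡p d≤k =
    trans (if-> (s≤s (far⇒k<s s d (suc-injective s+d≡p) d≤k))) (far⇒p∸s s d (suc-injective s+d≡p))

  data Position (s : ℕ) : Set where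
    near : s ≤ k → Position s
    far : ∀ d → s + d ≡ p → 1 ≤ d → d ≤ k → Position s

  position : ∀ s → s < p → Position s
  position s s<p with s ≤? k
  ... | yes s≤k = near s≤k
  ... | no s≰k = far (p ∸ s) (m+[n∸m]≡n (<⇒≤ s<p)) (m<n⇒0<n∸m s<p)
    (≤-trans (∸-monoʳ-≤ p (≰⇒> s≰k)) (≤-reflexive (trans (cong (_∸ suc k) p≡) (m+n∸m≡n k k))))

  far-k : ∀ s → s + k ≡ p → s ≡ suc k
  far-k s s+k≡p = +-cancelʳ-≡ k s (suc k) (trans s+k≡p p≡)

  dyFar-on-far : ∀ s d → s + d ≡ p → 1 ≤ d → d ≤ k → (d ≡ k × dyFar s ≡ k) ⊎ (suc d ≤ k × dyFar s ≡ suc d)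
  dyFar-on-far s d s+d≡p _ d≤k with m≤n⇒m<n∨m≡n d≤k
  ... | inj₂ refl = inj₁ (refl , trans (cong dyFar (far-k s s+d≡p)) (dyFar-near k ≤-refl))
  ... | inj₁ d<k = inj₂ (d<k , dyFar-far s (suc d) (trans (+-suc s d) (cong suc s+d≡p)) d<k)

  near-step : ∀ s → suc s < p →
    Near (dx₀ s) (dx₀ (suc s)) × Near (dx₁ s) (dx₁ (suc s)) × Near (dx₃ s) (dx₃ (suc s))
  near-step s s+1<p with position s (<-trans (n<1+n s) s+1<p)
  ... | near s≤k with m≤n⇒m<n∨m≡n s≤k
  ...   | inj₁ s<k = near-subst (dx₀-near s s≤k) (dx₀-near (suc s) s<k) (near-suc s)
                   , near-subst (dx₁-near s s≤k) (dx₁-near (suc s) s<k) (near-detour-suc s)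
                   , near-subst (dx₃-near s s≤k) (dx₃-near (suc s) s<k) (near-detour-suc s)
  ...   | inj₂ refl = near-subst (dx₀-near k s≤k) (dx₀-far (suc k) k (sym p≡) ≤-refl) (near-refl k)
                    , near-subst (dx₁-near k s≤k) (dx₁-far (suc k) k (sym p≡) ≤-refl) (near-refl k)
                    , near-subst (dx₃-near k s≤k) (dx₃-far (suc k) k (sym p≡) ≤-refl) (near-refl k)
  near-step s s+1<p | far 1 s+1≡p _ _ = ⊥-elim (<-irrefl (trans (+-comm 1 s) s+1≡p) s+1<p)
  near-step s s+1<p | far (suc (suc d)) s+d≡p _ d≤k =
      near-subst (dx₀-far s _ s+d≡p d≤k) (dx₀-far (suc s) (suc d) s+1+d≡p d+1≤k) (near-sym (near-detour-suc (suc d)))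
    , near-subst (dx₁-far s _ s+d≡p d≤k) (dx₁-far (suc s) (suc d) s+1+d≡p d+1≤k) (near-sym (near-detour-suc (suc d)))
    , near-subst (dx₃-far s _ s+d≡p d≤k) (dx₃-far (suc s) (suc d) s+1+d≡p d+1≤k) (near-pred (suc d))
    where
      s+1+d≡p : suc s + suc d ≡ p
      s+1+d≡p = trans (sym (+-suc s (suc d))) s+d≡p
      d+1≤k : suc d ≤ k
      d+1≤k = ≤-trans (n≤1+n (suc d)) d≤k

  e<p : ∀ e → suc (suc e) < p → e < p
  e<p e e+2<p = <-trans (n<1+n e) (<-trans (n<1+n (suc e)) e+2<p)

  NearAll : ℕ → ℕ → Set
  NearAll v s = Near v (dx₀ s) × Near v (dx₁ s) × Near v (dx₃ s)

  near-dyFar : ∀ s → 4 ≤ s → s < p → NearAll (dyFar s) s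
  near-dyFar s@(suc (suc (suc (suc e)))) (s≤s (s≤s (s≤s (s≤s z≤n)))) s<p with position s s<p
  ... | near s≤k = let dy≡ = dyFar-near (3 + e) (≤-trans (n≤1+n _) s≤k) in
        near-subst dy≡ (dx₀-near s s≤k) (near-suc _)
      , near-subst dy≡ (dx₁-near s s≤k) (near-suc _)
      , near-subst dy≡ (dx₃-near s s≤k) (near-suc _)
  ... | far d s+d≡p 1≤d d≤k with dyFar-on-far s d s+d≡p 1≤d d≤k
  ...   | inj₁ (refl , dy≡) =
        near-subst dy≡ (dx₀-far s k s+d≡p d≤k) (near-refl k)
      , near-subst dy≡ (dx₁-far s k s+d≡p d≤k) (near-refl k)
      , near-subst dy≡ (dx₃-far s k s+d≡p d≤k) (near-refl k)
  ...   | inj₂ (_ , dy≡) =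
        near-subst dy≡ (dx₀-far s d s+d≡p d≤k) (near-suc-detour d 1≤d)
      , near-subst dy≡ (dx₁-far s d s+d≡p d≤k) (near-suc-detour d 1≤d)
      , near-subst dy≡ (dx₃-far s d s+d≡p d≤k) (near-pred d)

  near-dyFar-shift : ∀ e → 2 ≤ e → suc (suc e) < p → NearAll (dyFar (suc (suc e))) e
  near-dyFar-shift e@(suc (suc _)) (s≤s (s≤s z≤n)) e+2<p with position e (e<p e e+2<p)
  ... | near e≤k with m≤n⇒m<n∨m≡n e≤k
  ...   | inj₁ e<k = let dy≡ = dyFar-near (suc e) e<k in
        near-subst dy≡ (dx₀-near e e≤k) (near-pred _)
      , near-subst dy≡ (dx₁-near e e≤k) (near-pred _)
      , near-subst dy≡ (dx₃-near e e≤k) (near-pred _)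
  ...   | inj₂ refl =
        let dy≡ = dyFar-far (suc (suc k)) k (cong suc (trans (+-comm (suc k) k) (trans (+-suc k k) (sym p≡)))) ≤-refl in
        near-subst dy≡ (dx₀-near k e≤k) (near-refl k)
      , near-subst dy≡ (dx₁-near k e≤k) (near-refl k)
      , near-subst dy≡ (dx₃-near k e≤k) (near-refl k)
  near-dyFar-shift e@(suc (suc _)) (s≤s (s≤s z≤n)) e+2<p | far (suc d) e+d≡p _ d≤k =
        near-subst dy≡ (dx₀-far e (suc d) e+d≡p d≤k) (near-detour d 2≤d)
      , near-subst dy≡ (dx₁-far e (suc d) e+d≡p d≤k) (near-detour d 2≤d)
      , near-subst dy≡ (dx₃-far e (suc d) e+d≡p d≤k) (near-suc d)
    where
      dy≡ : dyFar (suc (suc e)) ≡ d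
      dy≡ = dyFar-far (suc (suc e)) d (cong suc (trans (sym (+-suc e d)) e+d≡p)) (≤-trans (n≤1+n d) d≤k)
      2≤d : 2 ≤ d
      2≤d = ≤-pred (+-cancelˡ-≤ e 3 (suc d) (subst₂ _≤_ (+-comm 3 e) (sym e+d≡p) e+2<p))
      near-detour : ∀ d → 2 ≤ d → Near d (detour (suc d))
      near-detour (suc d) _ = near-suc (suc d)

  near-dy₀ : ∀ s → s < p → NearAll (dy₀ s) s
  near-dy₀ 0 _ = near-pred 0 , near-suc 1 , near-suc 1
  near-dy₀ 1 _ = near-pred 1 , near-suc 2 , near-suc 2
  near-dy₀ 2 _ = near-pred 2 , near-pred 2 , near-pred 2
  near-dy₀ 3 _ = near-pred 3 , near-pred 3 , near-pred 3
  near-dy₀ s@(suc (suc (suc (suc _)))) s<p = near-dyFar s (s≤s (s≤s (s≤s (s≤s z≤n)))) s<p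

  near-dy₁ : ∀ s → s < p → NearAll (dy₁ s) s
  near-dy₁ 0 _ = near-pred 0 , near-suc 1 , near-suc 1
  near-dy₁ 1 _ = near-pred 1 , near-suc 2 , near-suc 2
  near-dy₁ 2 _ = near-suc 1 , near-suc 1 , near-suc 1
  near-dy₁ 3 _ = near-suc 2 , near-suc 2 , near-suc 2
  near-dy₁ s@(suc (suc (suc (suc _)))) s<p = near-dyFar s (s≤s (s≤s (s≤s (s≤s z≤n)))) s<p

  near-dy₀-shift : ∀ e → suc (suc e) < p → Near (dy₀ (suc (suc e))) (dx₁ e) × Near (dy₀ (suc (suc e))) (dx₃ e)
  near-dy₀-shift 0 _ = near-pred 2 , near-pred 2
  near-dy₀-shift 1 _ = near-pred 3 , near-pred 3
  near-dy₀-shift e@(suc (suc _)) e+2<p = let _ , n₁ , n₃ = near-dyFar-shift e (s≤s (s≤s z≤n)) e+2<p in n₁ , n₃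

  near-dy₁-shift : ∀ e → suc (suc e) < p → Near (dy₁ (suc (suc e))) (dx₁ e) × Near (dy₁ (suc (suc e))) (dx₀ e)
  near-dy₁-shift 0 _ = near-suc 1 , near-pred 0
  near-dy₁-shift 1 _ = near-suc 2 , near-pred 1
  near-dy₁-shift e@(suc (suc _)) e+2<p = let n₀ , n₁ , _ = near-dyFar-shift e (s≤s (s≤s z≤n)) e+2<p in n₁ , n₀

  p₋₂ : ℕ
  p₋₂ = 2 * k ∸ 1

  p₋₂+2≡p : p₋₂ + 2 ≡ p
  p₋₂+2≡p = lemma K where
    lemma : ∀ K → 4 + K + suc (4 + K + 0) + 2 ≡ suc (2 * (5 + K))
    lemma = solve-∀

  p₋₂<p : p₋₂ < p
  p₋₂<p = ≤-by 1 (trans (sym (+-suc p₋₂ 1)) p₋₂+2≡p)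

  1+p₋₂<p : suc p₋₂ < p
  1+p₋₂<p = ≤-by 0 (trans (+-identityʳ _) (trans (+-comm 2 p₋₂) p₋₂+2≡p))

  offsetsᵖ : List ℕ
  offsetsᵖ = 0 ∷ p₋₂ ∷ p ∷ p + p ∷ p + p + p₋₂ ∷ p + p + p ∷ []

  offsets≡offsetsᵖ : offsets k ≡ offsetsᵖ
  offsets≡offsetsᵖ =
    cong (λ o → 0 ∷ p₋₂ ∷ o) (cong₂ _∷_ (+-comm (2 * k) 1) (cong₂ _∷_ 4k+2≡ (cong₂ _∷_ 6k+1≡ (cong (_∷ []) 6k+3≡))))
    where
      4k+2≡ : 4 * k + 2 ≡ p + p
      4k+2≡ = lemma K where
        lemma : ∀ K → 4 * (5 + K) + 2 ≡ suc (2 * (5 + K)) + suc (2 * (5 + K))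
        lemma = solve-∀
      6k+1≡ : 6 * k + 1 ≡ p + p + p₋₂
      6k+1≡ = lemma K where
        lemma : ∀ K → 6 * (5 + K) + 1 ≡ suc (2 * (5 + K)) + suc (2 * (5 + K)) + (4 + K + suc (4 + K + 0))
        lemma = solve-∀
      6k+3≡ : 6 * k + 3 ≡ p + p + p
      6k+3≡ = lemma K where
        lemma : ∀ K → 6 * (5 + K) + 3 ≡ suc (2 * (5 + K)) + suc (2 * (5 + K)) + suc (2 * (5 + K))
        lemma = solve-∀

  q₀<n : ∀ s → s < p → s < n
  q₀<n s s<p = <-≤-trans s<p (≤-by (p + p + p) (trans (lemma p) (sym n≡4p)))
    where lemma : ∀ p → p + (p + p + p) ≡ p + p + p + p
          lemma = solve-∀

  q₁<n : ∀ s → s < p → p + s < n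
  q₁<n s s<p = <-≤-trans (+-monoʳ-< p s<p) (≤-by (p + p) (trans (lemma p) (sym n≡4p)))
    where lemma : ∀ p → p + p + (p + p) ≡ p + p + p + p
          lemma = solve-∀

  q₂<n : ∀ s → s < p → p + p + s < n
  q₂<n s s<p = <-≤-trans (+-monoʳ-< (p + p) s<p) (≤-by p (sym n≡4p))

  q₃<n : ∀ s → s < p → p + p + p + s < n
  q₃<n s s<p = subst (p + p + p + s <_) (sym n≡4p) (+-monoʳ-< (p + p + p) s<p)

  distX-mod-q₀ : ∀ a s → s < p → a ≡ s → distX (a % n) ≡ dx₀ s
  distX-mod-q₀ a s s<p refl = trans (cong distX (m<n⇒m%n≡m (q₀<n s s<p))) (distX-q₀ s s<p)

  distX-mod-q₁ : ∀ a s → s < p → a ≡ p + s → distX (a % n) ≡ dx₁ s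
  distX-mod-q₁ a s s<p refl = trans (cong distX (m<n⇒m%n≡m (q₁<n s s<p))) (distX-q₁ s s<p)

  distX-mod-q₂ : ∀ a s → s < p → a ≡ p + p + s → distX (a % n) ≡ dx₁ s
  distX-mod-q₂ a s s<p refl = trans (cong distX (m<n⇒m%n≡m (q₂<n s s<p))) (distX-q₂ s s<p)

  distX-mod-q₃ : ∀ a s → s < p → a ≡ p + p + p + s → distX (a % n) ≡ dx₃ s
  distX-mod-q₃ a s s<p refl = trans (cong distX (m<n⇒m%n≡m (q₃<n s s<p))) (distX-q₃ s s<p)

  distX-mod-wrap : ∀ a s → s < p → a ≡ s + n → distX (a % n) ≡ dx₀ s
  distX-mod-wrap a s s<p refl = trans (cong distX ([m+n]%n≡m%n s n)) (distX-mod-q₀ s s s<p refl)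

  data QuarterView (r : ℕ) : Set where
    q₀ : ∀ s → s < p → r ≡ s → QuarterView r
    q₁ : ∀ s → s < p → r ≡ p + s → QuarterView r
    q₂ : ∀ s → s < p → r ≡ p + p + s → QuarterView r
    q₃ : ∀ s → s < p → r ≡ p + p + p + s → QuarterView r

  offset-split : ∀ r c → c ≤ r → r < c + p → ∃[ s ] s < p × r ≡ c + s
  offset-split r c c≤r r<c+p = r ∸ c , +-cancelˡ-< c (r ∸ c) p (subst (_< c + p) r≡ r<c+p) , r≡
    where
      r≡ : r ≡ c + (r ∸ c)
      r≡ = sym (m+[n∸m]≡n c≤r)

  quarterView : ∀ r → r < n → QuarterView r
  quarterView r r<n with r <? p
  ... | yes r<p = q₀ r r<p refl
  ... | no r≮p with r <? p + p
  ...   | yes r<2p = let s , s<p , eq = offset-split r p (≮⇒≥ r≮p) r<2p in q₁ s s<p eq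
  ...   | no r≮2p with r <? p + p + p
  ...     | yes r<3p = let s , s<p , eq = offset-split r (p + p) (≮⇒≥ r≮2p) r<3p in q₂ s s<p eq
  ...     | no r≮3p =
    let s , s<p , eq = offset-split r (p + p + p) (≮⇒≥ r≮3p) (subst (r <_) n≡4p r<n) in q₃ s s<p eq

  +1≡suc : ∀ c s → c + s + 1 ≡ c + suc s
  +1≡suc c s = trans (+-assoc c s 1) (cong (c +_) (+-comm s 1))

  last+1 : ∀ c s → suc s ≡ p → c + s + 1 ≡ c + p + 0
  last+1 c s 1+s≡p = trans (+1≡suc c s) (trans (cong (c +_) 1+s≡p) (sym (+-identityʳ (c + p))))

  last-far : ∀ s → suc s ≡ p → s + 1 ≡ p
  last-far s 1+s≡p = trans (+-comm s 1) 1+s≡p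

  near-distX-next : ∀ r → r < n → Near (distX r) (distX ((r + 1) % n))
  near-distX-next r r<n with quarterView r r<n
  ... | q₀ s s<p refl with m≤n⇒m<n∨m≡n s<p
  ...   | inj₁ s+1<p = near-subst (distX-q₀ s s<p) (distX-mod-q₀ (s + 1) (suc s) s+1<p (+-comm s 1))
                         (proj₁ (near-step s s+1<p))
  ...   | inj₂ 1+s≡p = near-subst (distX-q₀ s s<p) (distX-mod-q₁ (s + 1) 0 (s≤s z≤n) (last+1 0 s 1+s≡p))
                         (near-subst (dx₀-far s 1 (last-far s 1+s≡p) (s≤s z≤n)) refl (near-pred 2))
  near-distX-next r r<n | q₁ s s<p refl with m≤n⇒m<n∨m≡n s<p
  ...   | inj₁ s+1<p = near-subst (distX-q₁ s s<p) (distX-mod-q₁ (p + s + 1) (suc s) s+1<p (+1≡suc p s))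
                         (proj₁ (proj₂ (near-step s s+1<p)))
  ...   | inj₂ 1+s≡p = near-subst (distX-q₁ s s<p) (distX-mod-q₂ (p + s + 1) 0 (s≤s z≤n) (last+1 p s 1+s≡p))
                         (near-subst (dx₁-far s 1 (last-far s 1+s≡p) (s≤s z≤n)) refl (near-pred 2))
  near-distX-next r r<n | q₂ s s<p refl with m≤n⇒m<n∨m≡n s<p
  ...   | inj₁ s+1<p = near-subst (distX-q₂ s s<p) (distX-mod-q₂ (p + p + s + 1) (suc s) s+1<p (+1≡suc (p + p) s))
                         (proj₁ (proj₂ (near-step s s+1<p)))
  ...   | inj₂ 1+s≡p = near-subst (distX-q₂ s s<p) (distX-mod-q₃ (p + p + s + 1) 0 (s≤s z≤n) (last+1 (p + p) s 1+s≡p))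
                         (near-subst (dx₁-far s 1 (last-far s 1+s≡p) (s≤s z≤n)) refl (near-pred 2))
  near-distX-next r r<n | q₃ s s<p refl with m≤n⇒m<n∨m≡n s<p
  ...   | inj₁ s+1<p = near-subst (distX-q₃ s s<p) (distX-mod-q₃ (p + p + p + s + 1) (suc s) s+1<p (+1≡suc (p + p + p) s))
                         (proj₂ (proj₂ (near-step s s+1<p)))
  ...   | inj₂ 1+s≡p = near-subst (distX-q₃ s s<p)
                         (distX-mod-wrap (p + p + p + s + 1) 0 (s≤s z≤n)
                           (trans (last+1 (p + p + p) s 1+s≡p) (trans (+-identityʳ _) (sym n≡4p))))
                         (near-subst (dx₃-far s 1 (last-far s 1+s≡p) (s≤s z≤n)) refl (near-pred 0))

  3≤k : 3 ≤ k
  3≤k = s≤s (s≤s (s≤s z≤n))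

  dx₀-p₋₂ : dx₀ p₋₂ ≡ 2
  dx₀-p₋₂ = dx₀-far p₋₂ 2 p₋₂+2≡p (≤-trans (n≤1+n 2) 3≤k)
  dx₁-p₋₂ : dx₁ p₋₂ ≡ 2
  dx₁-p₋₂ = dx₁-far p₋₂ 2 p₋₂+2≡p (≤-trans (n≤1+n 2) 3≤k)
  dx₃-p₋₂ : dx₃ p₋₂ ≡ 2
  dx₃-p₋₂ = dx₃-far p₋₂ 2 p₋₂+2≡p (≤-trans (n≤1+n 2) 3≤k)

  2+p₋₂≡p : suc p₋₂ + 1 ≡ p
  2+p₋₂≡p = trans (cong suc (+-comm p₋₂ 1)) (trans (+-comm 2 p₋₂) p₋₂+2≡p)

  dx₀-p₋₁ : dx₀ (suc p₋₂) ≡ 3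
  dx₀-p₋₁ = dx₀-far (suc p₋₂) 1 2+p₋₂≡p (s≤s z≤n)
  dx₁-p₋₁ : dx₁ (suc p₋₂) ≡ 3
  dx₁-p₋₁ = dx₁-far (suc p₋₂) 1 2+p₋₂≡p (s≤s z≤n)
  dx₃-p₋₁ : dx₃ (suc p₋₂) ≡ 1
  dx₃-p₋₁ = dx₃-far (suc p₋₂) 1 2+p₋₂≡p (s≤s z≤n)

  near-y₀-x : ∀ T → T < p → ∀ m → m ∈ offsetsᵖ → Near (dy₀ T) (distX ((T + m) % n))
  near-y₀-x T T<p _ (here refl) =
    near-subst refl (distX-mod-q₀ (T + 0) T T<p (+-identityʳ T)) (proj₁ (near-dy₀ T T<p))
  near-y₀-x 0 _ _ (there (here refl)) =
    near-subst refl (trans (distX-mod-q₀ p₋₂ p₋₂ p₋₂<p refl) dx₀-p₋₂) (near-suc 1)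
  near-y₀-x 1 _ _ (there (here refl)) =
    near-subst refl (trans (distX-mod-q₀ (1 + p₋₂) (suc p₋₂) 1+p₋₂<p refl) dx₀-p₋₁) (near-suc 2)
  near-y₀-x (suc (suc e)) T<p _ (there (here refl)) =
    near-subst refl (distX-mod-q₁ (2 + e + p₋₂) e (e<p e T<p) (trans (lemma e p₋₂) (cong (_+ e) p₋₂+2≡p)))
      (proj₁ (near-dy₀-shift e T<p))
    where lemma : ∀ e q → 2 + e + q ≡ q + 2 + e
          lemma = solve-∀
  near-y₀-x T T<p _ (there (there (here refl))) =
    near-subst refl (distX-mod-q₁ (T + p) T T<p (+-comm T p)) (proj₁ (proj₂ (near-dy₀ T T<p)))
  near-y₀-x T T<p _ (there (there (there (here refl)))) =
    near-subst refl (distX-mod-q₂ (T + (p + p)) T T<p (+-comm T (p + p))) (proj₁ (proj₂ (near-dy₀ T T<p)))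
  near-y₀-x 0 _ _ (there (there (there (there (here refl))))) =
    near-subst refl (trans (distX-mod-q₂ (p + p + p₋₂) p₋₂ p₋₂<p refl) dx₁-p₋₂) (near-suc 1)
  near-y₀-x 1 _ _ (there (there (there (there (here refl))))) =
    near-subst refl (trans (distX-mod-q₂ (1 + (p + p + p₋₂)) (suc p₋₂) 1+p₋₂<p (sym (+-suc (p + p) p₋₂))) dx₁-p₋₁) (near-suc 2)
  near-y₀-x (suc (suc e)) T<p _ (there (there (there (there (here refl))))) =
    near-subst refl (distX-mod-q₃ (2 + e + (p + p + p₋₂)) e (e<p e T<p)
        (trans (lemma e p p₋₂) (cong (λ r → p + p + r + e) p₋₂+2≡p)))
      (proj₂ (near-dy₀-shift e T<p))
    where lemma : ∀ e p q → 2 + e + (p + p + q) ≡ p + p + (q + 2) + e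
          lemma = solve-∀
  near-y₀-x T T<p _ (there (there (there (there (there (here refl)))))) =
    near-subst refl (distX-mod-q₃ (T + (p + p + p)) T T<p (+-comm T (p + p + p))) (proj₂ (proj₂ (near-dy₀ T T<p)))

  near-y₁-x : ∀ s → s < p → ∀ m → m ∈ offsetsᵖ → Near (dy₁ s) (distX ((p + s + m) % n))
  near-y₁-x s s<p _ (here refl) =
    near-subst refl (distX-mod-q₁ (p + s + 0) s s<p (+-identityʳ (p + s))) (proj₁ (proj₂ (near-dy₁ s s<p)))
  near-y₁-x 0 _ _ (there (here refl)) =
    near-subst refl (trans (distX-mod-q₁ (p + 0 + p₋₂) p₋₂ p₋₂<p (cong (_+ p₋₂) (+-identityʳ p))) dx₁-p₋₂) (near-suc 1)
  near-y₁-x 1 _ _ (there (here refl)) =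
    near-subst refl (trans (distX-mod-q₁ (p + 1 + p₋₂) (suc p₋₂) 1+p₋₂<p (+-assoc p 1 p₋₂)) dx₁-p₋₁) (near-suc 2)
  near-y₁-x (suc (suc e)) s<p _ (there (here refl)) =
    near-subst refl (distX-mod-q₂ (p + (2 + e) + p₋₂) e (e<p e s<p) (trans (lemma p e p₋₂) (cong (λ r → p + r + e) p₋₂+2≡p)))
      (proj₁ (near-dy₁-shift e s<p))
    where lemma : ∀ p e q → p + (2 + e) + q ≡ p + (q + 2) + e
          lemma = solve-∀
  near-y₁-x s s<p _ (there (there (here refl))) =
    near-subst refl (distX-mod-q₂ (p + s + p) s s<p (lemma p s)) (proj₁ (proj₂ (near-dy₁ s s<p)))
    where lemma : ∀ p s → p + s + p ≡ p + p + s
          lemma = solve-∀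
  near-y₁-x s s<p _ (there (there (there (here refl)))) =
    near-subst refl (distX-mod-q₃ (p + s + (p + p)) s s<p (lemma p s)) (proj₂ (proj₂ (near-dy₁ s s<p)))
    where lemma : ∀ p s → p + s + (p + p) ≡ p + p + p + s
          lemma = solve-∀
  near-y₁-x 0 _ _ (there (there (there (there (here refl))))) =
    near-subst refl (trans (distX-mod-q₃ (p + 0 + (p + p + p₋₂)) p₋₂ p₋₂<p (lemma p p₋₂)) dx₃-p₋₂) (near-suc 1)
    where lemma : ∀ p q → p + 0 + (p + p + q) ≡ p + p + p + q
          lemma = solve-∀
  near-y₁-x 1 _ _ (there (there (there (there (here refl))))) =
    near-subst refl (trans (distX-mod-q₃ (p + 1 + (p + p + p₋₂)) (suc p₋₂) 1+p₋₂<p (lemma p p₋₂)) dx₃-p₋₁) (near-pred 1)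
    where lemma : ∀ p q → p + 1 + (p + p + q) ≡ p + p + p + (1 + q)
          lemma = solve-∀
  near-y₁-x (suc (suc e)) s<p _ (there (there (there (there (here refl))))) =
    near-subst refl (distX-mod-wrap (p + (2 + e) + (p + p + p₋₂)) e (e<p e s<p)
        (trans (lemma p e p₋₂) (trans (cong (λ r → e + (p + p + p + r)) p₋₂+2≡p) (cong (e +_) (sym n≡4p)))))
      (proj₂ (near-dy₁-shift e s<p))
    where lemma : ∀ p e q → p + (2 + e) + (p + p + q) ≡ e + (p + p + p + (q + 2))
          lemma = solve-∀
  near-y₁-x s s<p _ (there (there (there (there (there (here refl)))))) =
    near-subst refl (distX-mod-wrap (p + s + (p + p + p)) s s<p (trans (lemma p s) (cong (s +_) (sym n≡4p))))
      (proj₁ (near-dy₁ s s<p))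
    where lemma : ∀ p s → p + s + (p + p + p) ≡ s + (p + p + p + p)
          lemma = solve-∀

  QuarterFormula : ℕ → (ℕ → ℕ) → Set
  QuarterFormula c f = (∀ s → s < p → c + s < n) × (∀ s → s < p → distX (c + s) ≡ f s)

  formula-q₀ : QuarterFormula 0 dx₀
  formula-q₀ = q₀<n , distX-q₀

  formula-q₁ : QuarterFormula p dx₁
  formula-q₁ = q₁<n , distX-q₁

  formula-q₂ : QuarterFormula (p + p) dx₁
  formula-q₂ = q₂<n , distX-q₂

  formula-q₃ : QuarterFormula (p + p + p) dx₃
  formula-q₃ = q₃<n , distX-q₃

  n′ : ℕ
  n′ = 3 + 8 * k

  distX-prev : ∀ {c f} → QuarterFormula c f → ∀ s → suc s < p → distX ((c + suc s + n′) % n) ≡ f s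
  distX-prev {c} (c+s<n , reads) s s+1<p = trans (cong distX (begin
    (c + suc s + n′) % n ≡⟨ cong (_% n) (trans (cong (_+ n′) (+-suc c s)) (sym (+-suc (c + s) n′))) ⟩
    (c + s + n) % n      ≡⟨ [m+n]%n≡m%n (c + s) n ⟩
    (c + s) % n          ≡⟨ m<n⇒m%n≡m (c+s<n s s<p) ⟩
    c + s                ∎)) (reads s s<p)
    where
      open ≡-Reasoning
      s<p = <-trans (n<1+n s) s+1<p

  distX-next : ∀ {c f} → QuarterFormula c f → ∀ s → suc s < p → distX ((c + s + 1) % n) ≡ f (suc s)
  distX-next {c} (c+s<n , reads) s s+1<p = trans (cong distX (trans (cong (_% n) (+1≡suc c s))
    (m<n⇒m%n≡m (c+s<n (suc s) s+1<p)))) (reads (suc s) s+1<p)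

  data Parent (r m : ℕ) : Set where
    via-prev : distX ((r + n′) % n) ≡ m → Parent r m
    via-next : distX ((r + 1) % n) ≡ m → Parent r m
    via-y : ∀ T o → T < h → o ∈ offsetsᵖ → r ≡ (T + o) % n → distY T ≡ m → Parent r m

  pred-unique : ∀ {a b m} → a ≡ suc b → a ≡ suc m → b ≡ m
  pred-unique a≡ a≡′ = suc-injective (trans (sym a≡) a≡′)

  0<h : 0 < h
  0<h = s≤s z≤n

  p+2<h : p + 2 < h
  p+2<h = subst (p + 2 <_) (sym h≡2p) (+-monoʳ-< p (s≤s (s≤s (s≤s z≤n))))

  p<h : p < h
  p<h = <-trans (subst (_< p + 2) (+-identityʳ p) (+-monoʳ-< p (s≤s z≤n))) p+2<h

  distY-p+2 : distY (p + 2) ≡ 1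
  distY-p+2 = distY-q₁ 2

  quarter-mod : ∀ {c f} → QuarterFormula c f → ∀ s → s < p → (c + s) % n ≡ c + s
  quarter-mod (c+s<n , _) s s<p = m<n⇒m%n≡m (c+s<n s s<p)

  far-2 : ∀ s → s + 2 ≡ p → s ≡ p₋₂
  far-2 s s+2≡p = +-cancelʳ-≡ 2 s p₋₂ (trans s+2≡p (sym p₋₂+2≡p))

  far-step : ∀ s d → s + suc (suc d) ≡ p → suc s < p × suc s + suc d ≡ p
  far-step s d s+d≡p = ≤-by d (trans (sym (trans (+-suc s (suc d)) (cong suc (+-suc s d)))) s+d≡p)
                     , trans (sym (+-suc s (suc d))) s+d≡p

  parent-q₀ : ∀ s → s < p → ∀ m → dx₀ s ≡ suc m → Parent s m
  parent-q₀ (suc s) s<p m d≡ with position (suc s) s<p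
  ... | near s≤k = via-prev (trans (distX-prev formula-q₀ s s<p)
          (trans (dx₀-near s (≤-trans (n≤1+n s) s≤k)) (pred-unique (dx₀-near (suc s) s≤k) d≡)))
  ... | far 1 e _ d≤k = via-next (trans (distX-mod-q₁ (suc s + 1) 0 (s≤s z≤n) (trans e (sym (+-identityʳ p))))
          (pred-unique (dx₀-far (suc s) 1 e d≤k) d≡))
  ... | far 2 e _ d≤k = via-y 0 p₋₂ 0<h (there (here refl))
          (trans (sym (quarter-mod formula-q₀ (suc s) s<p)) (cong (_% n) (far-2 (suc s) e)))
          (pred-unique (dx₀-far (suc s) 2 e d≤k) d≡)
  ... | far (suc (suc (suc d))) e _ d≤k = let s+1<p , e′ = far-step (suc s) (suc d) e in
        via-next (trans (distX-next formula-q₀ (suc s) s+1<p)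
          (trans (dx₀-far (suc (suc s)) (suc (suc d)) e′ (≤-trans (n≤1+n _) d≤k)) (pred-unique (dx₀-far (suc s) _ e d≤k) d≡)))

  parent-q₁ : ∀ s → s < p → ∀ m → dx₁ s ≡ suc m → Parent (p + s) m
  parent-q₁ 0 s<p _ refl = via-y (p + 0) 0 (subst (_< h) (sym (+-identityʳ p)) p<h) (here refl)
    (sym (trans (cong (_% n) (+-identityʳ (p + 0))) (quarter-mod formula-q₁ 0 s<p))) (distY-q₁ 0)
  parent-q₁ 1 s<p _ refl = via-prev (distX-prev formula-q₁ 0 s<p)
  parent-q₁ 2 s<p _ refl = via-y (p + 2) 0 p+2<h (here refl)
    (sym (trans (cong (_% n) (+-identityʳ (p + 2))) (quarter-mod formula-q₁ 2 s<p))) distY-p+2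
  parent-q₁ s@(suc (suc (suc s′))) s<p m d≡ with position s s<p
  ... | near s≤k = via-prev (trans (distX-prev formula-q₁ (suc (suc s′)) s<p)
          (trans (dx₁-near (suc (suc s′)) (≤-trans (n≤1+n _) s≤k)) (pred-unique (dx₁-near s s≤k) d≡)))
  ... | far 1 e _ d≤k = via-next (trans (distX-mod-q₂ (p + s + 1) 0 (s≤s z≤n)
          (trans (+-assoc p s 1) (trans (cong (p +_) e) (sym (+-identityʳ (p + p))))))
          (pred-unique (dx₁-far s 1 e d≤k) d≡))
  ... | far 2 e _ d≤k = via-y (p + 0) p₋₂ (subst (_< h) (sym (+-identityʳ p)) p<h) (there (here refl))
          (sym (trans (cong (λ r → (p + 0 + r) % n) (sym (far-2 s e)))
            (trans (cong (λ r → (r + s) % n) (+-identityʳ p)) (quarter-mod formula-q₁ s s<p))))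
          (trans (distY-q₁ 0) (pred-unique (dx₁-far s 2 e d≤k) d≡))
  ... | far (suc (suc (suc d))) e _ d≤k = let s+1<p , e′ = far-step s (suc d) e in
        via-next (trans (distX-next formula-q₁ s s+1<p)
          (trans (dx₁-far (suc s) (suc (suc d)) e′ (≤-trans (n≤1+n _) d≤k)) (pred-unique (dx₁-far s _ e d≤k) d≡)))

  parent-q₂ : ∀ s → s < p → ∀ m → dx₁ s ≡ suc m → Parent (p + p + s) m
  parent-q₂ 0 s<p _ refl = via-y 0 (p + p) 0<h (there (there (there (here refl))))
    (sym (trans (cong (_% n) (sym (+-identityʳ (p + p)))) (quarter-mod formula-q₂ 0 s<p))) refl
  parent-q₂ 1 s<p _ refl = via-prev (distX-prev formula-q₂ 0 s<p)
  parent-q₂ 2 s<p _ refl = via-y (p + 2) p p+2<h (there (there (here refl)))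
    (sym (trans (cong (_% n) (lemma p)) (quarter-mod formula-q₂ 2 s<p))) distY-p+2
    where lemma : ∀ p → p + 2 + p ≡ p + p + 2
          lemma = solve-∀
  parent-q₂ s@(suc (suc (suc s′))) s<p m d≡ with position s s<p
  ... | near s≤k = via-prev (trans (distX-prev formula-q₂ (suc (suc s′)) s<p)
          (trans (dx₁-near (suc (suc s′)) (≤-trans (n≤1+n _) s≤k)) (pred-unique (dx₁-near s s≤k) d≡)))
  ... | far 1 e _ d≤k = via-next (trans (distX-mod-q₃ (p + p + s + 1) 0 (s≤s z≤n)
          (trans (+-assoc (p + p) s 1) (trans (cong (p + p +_) e) (sym (+-identityʳ (p + p + p))))))
          (pred-unique (dx₁-far s 1 e d≤k) d≡))
  ... | far 2 e _ d≤k = via-y 0 (p + p + p₋₂) 0<h (there (there (there (there (here refl)))))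
          (sym (trans (cong (λ r → (p + p + r) % n) (sym (far-2 s e))) (quarter-mod formula-q₂ s s<p)))
          (pred-unique (dx₁-far s 2 e d≤k) d≡)
  ... | far (suc (suc (suc d))) e _ d≤k = let s+1<p , e′ = far-step s (suc d) e in
        via-next (trans (distX-next formula-q₂ s s+1<p)
          (trans (dx₁-far (suc s) (suc (suc d)) e′ (≤-trans (n≤1+n _) d≤k)) (pred-unique (dx₁-far s _ e d≤k) d≡)))

  parent-q₃ : ∀ s → s < p → ∀ m → dx₃ s ≡ suc m → Parent (p + p + p + s) m
  parent-q₃ 0 s<p _ refl = via-y 0 (p + p + p) 0<h (there (there (there (there (there (here refl))))))
    (sym (trans (cong (_% n) (sym (+-identityʳ (p + p + p)))) (quarter-mod formula-q₃ 0 s<p))) refl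
  parent-q₃ 1 s<p _ refl = via-prev (distX-prev formula-q₃ 0 s<p)
  parent-q₃ 2 s<p _ refl = via-y (p + 2) (p + p) p+2<h (there (there (there (here refl))))
    (sym (trans (cong (_% n) (lemma p)) (quarter-mod formula-q₃ 2 s<p))) distY-p+2
    where lemma : ∀ p → p + 2 + (p + p) ≡ p + p + p + 2
          lemma = solve-∀
  parent-q₃ s@(suc (suc (suc s′))) s<p m d≡ with position s s<p
  ... | near s≤k = via-prev (trans (distX-prev formula-q₃ (suc (suc s′)) s<p)
          (trans (dx₃-near (suc (suc s′)) (≤-trans (n≤1+n _) s≤k)) (pred-unique (dx₃-near s s≤k) d≡)))
  ... | far 1 e _ d≤k = via-next (trans (distX-mod-wrap (p + p + p + s + 1) 0 (s≤s z≤n)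
          (trans (+-assoc (p + p + p) s 1) (trans (cong (p + p + p +_) e) (sym n≡4p))))
          (pred-unique (dx₃-far s 1 e d≤k) d≡))
  ... | far (suc (suc d)) e _ d≤k = let s+1<p , e′ = far-step s d e in
        via-next (trans (distX-next formula-q₃ s s+1<p)
          (trans (dx₃-far (suc s) (suc d) e′ (≤-trans (n≤1+n _) d≤k)) (pred-unique (dx₃-far s _ e d≤k) d≡)))

  data FarView (s : ℕ) : Set where
    below : ∀ s′ → s ≡ suc s′ → s′ ≤ k → FarView s
    above : ∀ d → s + d ≡ p → 1 ≤ d → d < k → FarView s

  farView : ∀ s → 1 ≤ s → s < p → FarView s
  farView (suc s′) _ s<p with position (suc s′) s<p
  ... | near s≤k = below s′ refl (≤-trans (n≤1+n s′) s≤k)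
  ... | far d e 1≤d d≤k with m≤n⇒m<n∨m≡n d≤k
  ...   | inj₁ d<k = above d e 1≤d d<k
  ...   | inj₂ refl = below s′ refl (≤-reflexive (suc-injective (far-k (suc s′) e)))

  dyFar-above : ∀ s d → s + d ≡ p → d < k → dyFar s ≡ suc d
  dyFar-above s d e d<k = dyFar-far s (suc d) (trans (+-suc s d) (cong suc e)) d<k

  parent-y₀ : ∀ T → T < p → ∀ m → dy₀ T ≡ suc m → ∃[ o ] o ∈ offsetsᵖ × distX ((T + o) % n) ≡ m
  parent-y₀ 0 _ _ refl = 0 , here refl , refl
  parent-y₀ 1 T<p _ refl = 0 , here refl , distX-mod-q₀ (1 + 0) 1 T<p refl
  parent-y₀ 2 T<p _ refl = 0 , here refl , distX-mod-q₀ (2 + 0) 2 T<p refl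
  parent-y₀ 3 T<p _ refl = 0 , here refl , distX-mod-q₀ (3 + 0) 3 T<p refl
  parent-y₀ T@(suc (suc (suc (suc e)))) T<p m d≡ with farView T (s≤s z≤n) T<p
  ... | below s′ refl s′≤k = p₋₂ , there (here refl) ,
        trans (distX-mod-q₁ (T + p₋₂) (suc (suc e)) (<-trans (n<1+n _) (<-trans (n<1+n _) T<p))
                (trans (lemma e p₋₂) (cong (_+ (2 + e)) p₋₂+2≡p)))
              (trans (dx₁-near (suc (suc e)) (≤-trans (n≤1+n _) s′≤k)) (pred-unique (dyFar-near s′ s′≤k) d≡))
    where lemma : ∀ e q → 4 + e + q ≡ q + 2 + (2 + e)
          lemma = solve-∀
  ... | above d e′ _ d<k = p + p + p , there (there (there (there (there (here refl))))) ,
        trans (distX-mod-q₃ (T + (p + p + p)) T T<p (+-comm T (p + p + p)))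
              (trans (dx₃-far T d e′ (<⇒≤ d<k)) (pred-unique (dyFar-above T d e′ d<k) d≡))

  parent-y₁ : ∀ s → s < p → ∀ m → dy₁ s ≡ suc m → ∃[ o ] o ∈ offsetsᵖ × distX ((p + s + o) % n) ≡ m
  parent-y₁ 0 s<p _ refl = p + p + p , there (there (there (there (there (here refl))))) ,
    distX-mod-wrap (p + 0 + (p + p + p)) 0 s<p (trans (lemma p) (sym n≡4p))
    where lemma : ∀ p → p + 0 + (p + p + p) ≡ p + p + p + p
          lemma = solve-∀
  parent-y₁ 1 s<p _ refl = p + p + p , there (there (there (there (there (here refl))))) ,
    distX-mod-wrap (p + 1 + (p + p + p)) 1 s<p (trans (lemma p) (cong (1 +_) (sym n≡4p)))
    where lemma : ∀ p → p + 1 + (p + p + p) ≡ 1 + (p + p + p + p)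
          lemma = solve-∀
  parent-y₁ 2 _ _ refl = p + p + p₋₂ , there (there (there (there (here refl)))) ,
    distX-mod-wrap (p + 2 + (p + p + p₋₂)) 0 (s≤s z≤n)
      (trans (lemma p p₋₂) (trans (cong (λ r → p + p + p + r) p₋₂+2≡p) (sym n≡4p)))
    where lemma : ∀ p q → p + 2 + (p + p + q) ≡ p + p + p + (q + 2)
          lemma = solve-∀
  parent-y₁ s@(suc (suc (suc e))) s<p m d≡ with farView s (s≤s z≤n) s<p
  ... | below s′ refl s′≤k = p + p + p₋₂ , there (there (there (there (here refl)))) ,
        trans (distX-mod-wrap (p + s + (p + p + p₋₂)) (suc e) (<-trans (n<1+n _) (<-trans (n<1+n _) s<p))
                (trans (lemma p e p₋₂) (trans (cong (λ r → suc e + (p + p + p + r)) p₋₂+2≡p) (cong (suc e +_) (sym n≡4p)))))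
              (trans (dx₀-near (suc e) (≤-trans (n≤1+n _) s′≤k)) (pred-unique (dyFar-near s′ s′≤k) d≡))
    where lemma : ∀ p e q → p + (3 + e) + (p + p + q) ≡ (1 + e) + (p + p + p + (q + 2))
          lemma = solve-∀
  ... | above d e′ _ d<k = p + p , there (there (there (here refl))) ,
        trans (distX-mod-q₃ (p + s + (p + p)) s s<p (lemma p s))
              (trans (dx₃-far s d e′ (<⇒≤ d<k)) (pred-unique (dyFar-above s d e′ d<k) d≡))
    where lemma : ∀ p s → p + s + (p + p) ≡ p + p + p + s
          lemma = solve-∀

  positive-≤k : ∀ {v w} → v ≡ w → w ≢ 0 → w ≤ k → v ≢ 0 × v ≤ k
  positive-≤k refl w≢0 w≤k = w≢0 , w≤k

  dx₀-range : ∀ s → s < p → (dx₀ s ≡ 0 → s ≡ 0) × dx₀ s ≤ k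
  dx₀-range s s<p with position s s<p
  ... | near s≤k = trans (sym (dx₀-near s s≤k)) , subst (_≤ k) (sym (dx₀-near s s≤k)) s≤k
  ... | far d e _ d≤k = let d≢0 , d≤ = positive-≤k (dx₀-far s d e d≤k) (detour≢0 d) (detour-≤ d 3≤k d≤k) in
                        ⊥-elim ∘ d≢0 , d≤

  dx₁-range : ∀ s → s < p → dx₁ s ≢ 0 × dx₁ s ≤ k
  dx₁-range s s<p with position s s<p
  ... | near s≤k = positive-≤k (dx₁-near s s≤k) (detour≢0 s) (detour-≤ s 3≤k s≤k)
  ... | far d e _ d≤k = positive-≤k (dx₁-far s d e d≤k) (detour≢0 d) (detour-≤ d 3≤k d≤k)

  dx₃-range : ∀ s → s < p → dx₃ s ≢ 0 × dx₃ s ≤ k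
  dx₃-range s s<p with position s s<p
  ... | near s≤k = positive-≤k (dx₃-near s s≤k) (detour≢0 s) (detour-≤ s 3≤k s≤k)
  ... | far (suc d) e _ d≤k = positive-≤k (dx₃-far s (suc d) e d≤k) 1+n≢0 d≤k

  only-at-0 : ∀ {r v} → distX r ≡ v → v ≢ 0 × v ≤ k → (distX r ≡ 0 → r ≡ 0) × distX r ≤ k
  only-at-0 refl (v≢0 , v≤k) = ⊥-elim ∘ v≢0 , v≤k

  distX-range : ∀ r → r < n → (distX r ≡ 0 → r ≡ 0) × distX r ≤ k
  distX-range r r<n with quarterView r r<n
  ... | q₀ s s<p refl = subst (λ v → (v ≡ 0 → s ≡ 0) × v ≤ k) (sym (distX-q₀ s s<p)) (dx₀-range s s<p)
  ... | q₁ s s<p refl = only-at-0 (distX-q₁ s s<p) (dx₁-range s s<p)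
  ... | q₂ s s<p refl = only-at-0 (distX-q₂ s s<p) (dx₁-range s s<p)
  ... | q₃ s s<p refl = only-at-0 (distX-q₃ s s<p) (dx₃-range s s<p)

  dyFar-range : ∀ s → 3 ≤ s → s < p → dyFar s ≢ 0 × dyFar s ≤ k
  dyFar-range s@(suc (suc (suc _))) (s≤s (s≤s (s≤s z≤n))) s<p with farView s (s≤s z≤n) s<p
  ... | below s′@(suc (suc _)) refl s′≤k = positive-≤k (dyFar-near s′ s′≤k) 1+n≢0 s′≤k
  ... | above d e _ d<k = positive-≤k (dyFar-above s d e d<k) 1+n≢0 d<k

  distY-range : ∀ T → T < h → distY T ≢ 0 × distY T ≤ k
  distY-range T T<h with T <? p
  ... | yes T<p = subst (λ v → v ≢ 0 × v ≤ k) (sym (distY-q₀ T T<p)) (dy₀-range T T<p)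
    where
      dy₀-range : ∀ T → T < p → dy₀ T ≢ 0 × dy₀ T ≤ k
      dy₀-range 0 _ = (λ ()) , s≤s z≤n
      dy₀-range 1 _ = (λ ()) , s≤s (s≤s z≤n)
      dy₀-range 2 _ = (λ ()) , 3≤k
      dy₀-range 3 _ = (λ ()) , s≤s (s≤s (s≤s (s≤s z≤n)))
      dy₀-range T@(suc (suc (suc (suc _)))) T<p = dyFar-range T (s≤s (s≤s (s≤s z≤n))) T<p
  ... | no T≮p = let s , s<p , T≡ = offset-split T p (≮⇒≥ T≮p) (subst (T <_) h≡2p T<h) in
      subst (λ v → v ≢ 0 × v ≤ k) (sym (trans (cong distY T≡) (distY-q₁ s))) (dy₁-range s s<p)
    where
      dy₁-range : ∀ s → s < p → dy₁ s ≢ 0 × dy₁ s ≤ k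
      dy₁-range 0 _ = (λ ()) , s≤s z≤n
      dy₁-range 1 _ = (λ ()) , s≤s (s≤s z≤n)
      dy₁-range 2 _ = (λ ()) , s≤s z≤n
      dy₁-range s@(suc (suc (suc _))) s<p = dyFar-range s (s≤s (s≤s (s≤s z≤n))) s<p

  near-distY-x : ∀ T → T < h → ∀ o → o ∈ offsetsᵖ → Near (distY T) (distX ((T + o) % n))
  near-distY-x T T<h o o∈ with T <? p
  ... | yes T<p = near-subst (distY-q₀ T T<p) refl (near-y₀-x T T<p o o∈)
  ... | no T≮p with offset-split T p (≮⇒≥ T≮p) (subst (T <_) h≡2p T<h)
  ...   | s , s<p , refl = near-subst (distY-q₁ s) refl (near-y₁-x s s<p o o∈)

  module X = Cyclic (3 + 8 * k)

  toℕ-eqF : ∀ {a} m → T (eqF a (m mod n)) → toℕ a ≡ m % n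
  toℕ-eqF {a} m = Equivalence.to (X.≡-mod⇔ a m) ∘ Equivalence.to eqF⇔≡

  adjYX⇔ : ∀ i a → T (adjYX k i a) ⇔ (∃[ o ] o ∈ offsetsᵖ × toℕ a ≡ (toℕ i + o) % n)
  adjYX⇔ i a = mk⇔
    (λ t → let o , o∈ , t′ = find (any⁻ hits (offsets k) t) in
           o , subst (o ∈_) offsets≡offsetsᵖ o∈ , toℕ-eqF (toℕ i + o) t′)
    (λ (o , o∈ , a≡) → any⁺ hits (lose {P = T ∘ hits} (subst (o ∈_) (sym offsets≡offsetsᵖ) o∈)
      (Equivalence.from eqF⇔≡ (Equivalence.from (X.≡-mod⇔ a (toℕ i + o)) a≡))))
    where
      hits : ℕ → Bool
      hits o = eqF a ((toℕ i + o) mod n)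

  label : V k → ℕ
  label (x a) = distX (toℕ a)
  label (y i) = distY (toℕ i)

  label-edge : ∀ w v → T (adj k w v) → label v ≤ suc (label w)
  label-edge (x a) (x b) t with Equivalence.to (T-∨ {eqF b ((toℕ a + 1) mod n)}) t
  ... | inj₁ b≡ = subst (λ r → distX r ≤ suc (distX (toℕ a))) (sym (toℕ-eqF (toℕ a + 1) b≡))
                    (proj₂ (near-distX-next (toℕ a) (Finₚ.toℕ<n a)))
  ... | inj₂ a≡ = subst (λ r → distX (toℕ b) ≤ suc (distX r)) (sym (toℕ-eqF (toℕ b + 1) a≡))
                    (proj₁ (near-distX-next (toℕ b) (Finₚ.toℕ<n b)))
  label-edge (x a) (y i) t = let o , o∈ , a≡ = Equivalence.to (adjYX⇔ i a) t in
    subst (λ r → distY (toℕ i) ≤ suc (distX r)) (sym a≡) (proj₁ (near-distY-x (toℕ i) (Finₚ.toℕ<n i) o o∈))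
  label-edge (y i) (x a) t = let o , o∈ , a≡ = Equivalence.to (adjYX⇔ i a) t in
    subst (λ r → distX r ≤ suc (distY (toℕ i))) (sym a≡) (proj₂ (near-distY-x (toℕ i) (Finₚ.toℕ<n i) o o∈))

  parent-x : ∀ r → r < n → ∀ m → distX r ≡ suc m → Parent r m
  parent-x r r<n m d≡ with quarterView r r<n
  ... | q₀ s s<p refl = parent-q₀ s s<p m (trans (sym (distX-q₀ s s<p)) d≡)
  ... | q₁ s s<p refl = parent-q₁ s s<p m (trans (sym (distX-q₁ s s<p)) d≡)
  ... | q₂ s s<p refl = parent-q₂ s s<p m (trans (sym (distX-q₂ s s<p)) d≡)
  ... | q₃ s s<p refl = parent-q₃ s s<p m (trans (sym (distX-q₃ s s<p)) d≡)

  parent-y : ∀ T → T < h → ∀ m → distY T ≡ suc m → ∃[ o ] o ∈ offsetsᵖ × distX ((T + o) % n) ≡ m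
  parent-y T T<h m d≡ with T <? p
  ... | yes T<p = parent-y₀ T T<p m (trans (sym (distY-q₀ T T<p)) d≡)
  ... | no T≮p with offset-split T p (≮⇒≥ T≮p) (subst (T <_) h≡2p T<h)
  ...   | s , s<p , refl = parent-y₁ s s<p m (trans (sym (distY-q₁ s)) d≡)

  label-parent : ∀ v m → label v ≡ suc m → ∃[ w ] T (adj k w v) × label w ≡ m
  label-parent (x a) m d≡ with parent-x (toℕ a) (Finₚ.toℕ<n a) m d≡
  ... | via-prev d≡′ = x (X.prev a) , prev-adj , trans (cong distX (X.toℕ-mod (toℕ a + n′))) d≡′
    where
      prev-adj : T (adj k (x (X.prev a)) (x a))
      prev-adj = Equivalence.from (T-∨ {eqF a ((toℕ (X.prev a) + 1) mod n)})
                   (inj₁ (Equivalence.from eqF⇔≡ (sym (X.next-prev a))))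
  ... | via-next d≡′ = x (X.next a) , next-adj , trans (cong distX (X.toℕ-mod (toℕ a + 1))) d≡′
    where
      next-adj : T (adj k (x (X.next a)) (x a))
      next-adj = Equivalence.from (T-∨ {eqF a ((toℕ (X.next a) + 1) mod n)}) (inj₂ (Equivalence.from eqF⇔≡ refl))
  ... | via-y i o i<h o∈ a≡ d≡′ = y (fromℕ< i<h) , y-adj , trans (cong distY (Finₚ.toℕ-fromℕ< i<h)) d≡′
    where
      y-adj : T (adj k (y (fromℕ< i<h)) (x a))
      y-adj = Equivalence.from (adjYX⇔ (fromℕ< i<h) a)
                (o , o∈ , trans a≡ (cong (λ t → (t + o) % n) (sym (Finₚ.toℕ-fromℕ< i<h))))
  label-parent (y i) m d≡ = let o , o∈ , d≡′ = parent-y (toℕ i) (Finₚ.toℕ<n i) m d≡ in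
    x ((toℕ i + o) mod n) , Equivalence.from (adjYX⇔ i _) (o , o∈ , X.toℕ-mod (toℕ i + o))
                          , trans (cong distX (X.toℕ-mod (toℕ i + o))) d≡′

  k<|V| : k < length (allV k)
  k<|V| = <-≤-trans (q₀<n k k<p) (≤-trans (m≤m+n n h) (≤-reflexive (sym (length-allV k))))

  labellingFromX₀ : DistanceLabelling k (x fzero)
  labellingFromX₀ = record
    { label = label
    ; label-source = refl
    ; label≡0⇒source = λ
        { (x a) d≡0 → cong x (Finₚ.toℕ-injective (proj₁ (distX-range (toℕ a) (Finₚ.toℕ<n a)) d≡0))
        ; (y i) d≡0 → ⊥-elim (proj₁ (distY-range (toℕ i) (Finₚ.toℕ<n i)) d≡0) }
    ; label-edge = label-edge
    ; label-parent = label-parent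
    ; label<size = λ
        { (x a) → ≤-<-trans (proj₂ (distX-range (toℕ a) (Finₚ.toℕ<n a))) k<|V|
        ; (y i) → ≤-<-trans (proj₂ (distY-range (toℕ i) (Finₚ.toℕ<n i))) k<|V| }
    }

  dist-x₀ : ∀ v → dist k (x fzero) v ≡ label v
  dist-x₀ = DistanceLabelling.dist≡label labellingFromX₀

-- The profile of the edge x₀x₁

module EdgeProfile (K : ℕ) where

  open Distances K
  open Rotation k (s≤s z≤n) using (rotate; unrotate; rotation; rotation^-x)

  dist-x₁ : ∀ w → dist k (rotate (x fzero)) w ≡ label (unrotate w)
  dist-x₁ w = begin
    dist k (rotate (x fzero)) w                     ≡⟨ cong (dist k (rotate (x fzero))) (Automorphism.to-from rotation w) ⟨
    dist k (rotate (x fzero)) (rotate (unrotate w)) ≡⟨ Automorphism.dist-to rotation (x fzero) (unrotate w) ⟩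
    dist k (x fzero) (unrotate w)                   ≡⟨ dist-x₀ (unrotate w) ⟩
    label (unrotate w)                              ∎
    where open ≡-Reasoning

  h′ : ℕ
  h′ = 1 + 4 * k

  pairsX pairsY : (ℕ → ℕ → Bool) → ℕ → Bool
  pairsX Q r = Q (distX r) (distX ((r + n′) % n))
  pairsY Q T = Q (distY T) (distY ((T + h′) % h))

  opaque
    unfolding distanceCount

    count-x₀x₁ : ∀ Q → distanceCount k Q (x fzero) (rotate (x fzero)) ≡ count< n (pairsX Q) + count< h (pairsY Q)
    count-x₀x₁ Q = begin
      count (λ w → Q (dist k (x fzero) w) (dist k (rotate (x fzero)) w)) (allV k)
        ≡⟨ count-cong (allV k) (λ w → cong₂ Q (dist-x₀ w) (dist-x₁ w)) ⟩
      count L (map x (allFin n) ++ map y (allFin h))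
        ≡⟨ count-++ L (map x (allFin n)) (map y (allFin h)) ⟩
      count L (map x (allFin n)) + count L (map y (allFin h))
        ≡⟨ cong₂ _+_ (trans (count-map L x (allFin n)) (count-tabulate (L ∘ x) n id (pairsX Q) x-pairs))
                     (trans (count-map L y (allFin h)) (count-tabulate (L ∘ y) h id (pairsY Q) y-pairs)) ⟩
      count< n (pairsX Q) + count< h (pairsY Q) ∎
      where
        open ≡-Reasoning
        module Y = Cyclic (1 + 4 * k)
        L : V k → Bool
        L w = Q (label w) (label (unrotate w))
        x-pairs : ∀ a → L (x a) ≡ pairsX Q (toℕ a)
        x-pairs a = cong (λ r → Q (distX (toℕ a)) (distX r)) (X.toℕ-mod (toℕ a + n′))
        y-pairs : ∀ i → L (y i) ≡ pairsY Q (toℕ i)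
        y-pairs i = cong (λ r → Q (distY (toℕ i)) (distY r)) (Y.toℕ-mod (toℕ i + h′))

  count<-p : ∀ G → count< p G ≡ [ G 0 ] + count< (k + k) (G ∘ suc)
  count<-p G = cong (λ m → count< m G) p≡

  count<-4p : ∀ G → count< n G
    ≡ count< p G + (count< p (λ i → G (p + i)) + (count< p (λ i → G (p + p + i)) + count< p (λ i → G (p + p + p + i))))
  count<-4p G = begin
    count< n G                   ≡⟨ cong (λ m → count< m G) n≡4p ⟩
    count< (p + p + p + p) G     ≡⟨ count<-+ (p + p + p) p G ⟩
    count< (p + p + p) G + c₃    ≡⟨ cong (_+ c₃) (count<-+ (p + p) p G) ⟩
    count< (p + p) G + c₂ + c₃   ≡⟨ cong (λ r → r + c₂ + c₃) (count<-+ p p G) ⟩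
    count< p G + c₁ + c₂ + c₃    ≡⟨ trans (+-assoc (count< p G + c₁) c₂ c₃) (+-assoc (count< p G) c₁ (c₂ + c₃)) ⟩
    count< p G + (c₁ + (c₂ + c₃)) ∎
    where
      open ≡-Reasoning
      c₁ c₂ c₃ : ℕ
      c₁ = count< p (λ i → G (p + i))
      c₂ = count< p (λ i → G (p + p + i))
      c₃ = count< p (λ i → G (p + p + p + i))

  far-x : ∀ s d → s + d ≡ k + suc (suc (4 + K)) → s + d ≡ p
  far-x s d e = trans e (lemma K)
    where lemma : ∀ K → 5 + K + suc (suc (4 + K)) ≡ suc (2 * (5 + K))
          lemma = solve-∀

  up down : (ℕ → ℕ → Bool) → ℕ
  up Q = ascents Q 3 (2 + K)
  down Q = descents Q 3 (2 + K)

  steps : (ℕ → ℕ) → (ℕ → ℕ → Bool) → ℕ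
  steps f Q = count< (k + k) (λ s → Q (f (suc s)) (f s))

  steps-dx₀ : ∀ Q → steps dx₀ Q
    ≡ [ Q 1 0 ] + ([ Q 2 1 ] + ([ Q 3 2 ] + up Q))
      + ([ Q k k ] + ([ Q 3 2 ] + ([ Q 2 3 ] + down Q)))
  steps-dx₀ Q = steps-split k (4 + K) Q dx₀ (λ s → s) detour dx₀-near (λ s d e d≤k → dx₀-far s d (far-x s d e) d≤k)

  steps-dx₁ : ∀ Q → steps dx₁ Q
    ≡ [ Q 3 2 ] + ([ Q 2 3 ] + ([ Q 3 2 ] + up Q))
      + ([ Q k k ] + ([ Q 3 2 ] + ([ Q 2 3 ] + down Q)))
  steps-dx₁ Q = steps-split k (4 + K) Q dx₁ detour detour dx₁-near (λ s d e d≤k → dx₁-far s d (far-x s d e) d≤k)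

  steps-dx₃ : ∀ Q → steps dx₃ Q
    ≡ [ Q 3 2 ] + ([ Q 2 3 ] + ([ Q 3 2 ] + up Q))
      + ([ Q k k ] + ([ Q 1 2 ] + ([ Q 2 3 ] + down Q)))
  steps-dx₃ Q = steps-split k (4 + K) Q dx₃ detour (λ d → d) dx₃-near (λ s d e d≤k → dx₃-far s d (far-x s d e) d≤k)

  k+k≡ : k + k ≡ suc k + suc (3 + K)
  k+k≡ = lemma K where
    lemma : ∀ K → 5 + K + (5 + K) ≡ suc (5 + K) + suc (3 + K)
    lemma = solve-∀

  far-y : ∀ s d → s + d ≡ suc k + suc (suc (3 + K)) → s + d ≡ p
  far-y s d e = trans e (lemma K)
    where lemma : ∀ K → suc (5 + K) + suc (suc (3 + K)) ≡ suc (2 * (5 + K))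
          lemma = solve-∀

  dyFar-below : ∀ s → 1 ≤ s → s ≤ suc k → dyFar s ≡ pred s
  dyFar-below (suc s) _ (s≤s s≤k) = dyFar-near s s≤k

  far-y-large : ∀ s d → s + d ≡ suc k + suc (suc (3 + K)) → d ≤ suc (3 + K) → s ≤ 3 → ⊥
  far-y-large s d e d≤ s≤3 = <⇒≱ (far⇒k<s s d (far-y s d e) (m≤n⇒m≤1+n d≤)) (≤-trans s≤3 3≤k)

  steps-dy₀ : ∀ Q → steps dy₀ Q
    ≡ [ Q 2 1 ] + ([ Q 3 2 ] + ([ Q 4 3 ] + ([ Q 3 4 ] + up Q)))
      + ([ Q k k ] + ([ Q 2 3 ] + down Q))
  steps-dy₀ Q = trans (cong (λ m → count< m (λ s → Q (dy₀ (suc s)) (dy₀ s))) k+k≡)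
    (steps-split (suc k) (3 + K) Q dy₀ g suc agree-near agree-far)
    where
      g : ℕ → ℕ
      g 0 = 1
      g 1 = 2
      g 2 = 3
      g 3 = 4
      g s@(suc (suc (suc (suc _)))) = pred s
      agree-near : ∀ s → s ≤ suc k → dy₀ s ≡ g s
      agree-near 0 _ = refl
      agree-near 1 _ = refl
      agree-near 2 _ = refl
      agree-near 3 _ = refl
      agree-near s@(suc (suc (suc (suc _)))) s≤1+k = dyFar-below s (s≤s z≤n) s≤1+k
      agree-far : ∀ s d → s + d ≡ suc k + suc (suc (3 + K)) → d ≤ suc (3 + K) → dy₀ s ≡ suc d
      agree-far 0 d e d≤ = ⊥-elim (far-y-large 0 d e d≤ z≤n)
      agree-far 1 d e d≤ = ⊥-elim (far-y-large 1 d e d≤ (s≤s z≤n))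
      agree-far 2 d e d≤ = ⊥-elim (far-y-large 2 d e d≤ (s≤s (s≤s z≤n)))
      agree-far 3 d e d≤ = ⊥-elim (far-y-large 3 d e d≤ (s≤s (s≤s (s≤s z≤n))))
      agree-far s@(suc (suc (suc (suc _)))) d e d≤ = dyFar-above s d (far-y s d e) (s≤s d≤)

  steps-dy₁ : ∀ Q → steps dy₁ Q
    ≡ [ Q 2 1 ] + ([ Q 1 2 ] + ([ Q 2 1 ] + ([ Q 3 2 ] + up Q)))
      + ([ Q k k ] + ([ Q 2 3 ] + down Q))
  steps-dy₁ Q = trans (cong (λ m → count< m (λ s → Q (dy₁ (suc s)) (dy₁ s))) k+k≡)
    (steps-split (suc k) (3 + K) Q dy₁ g suc agree-near agree-far)
    where
      g : ℕ → ℕ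
      g 0 = 1
      g 1 = 2
      g 2 = 1
      g s@(suc (suc (suc _))) = pred s
      agree-near : ∀ s → s ≤ suc k → dy₁ s ≡ g s
      agree-near 0 _ = refl
      agree-near 1 _ = refl
      agree-near 2 _ = refl
      agree-near s@(suc (suc (suc _))) s≤1+k = dyFar-below s (s≤s z≤n) s≤1+k
      agree-far : ∀ s d → s + d ≡ suc k + suc (suc (3 + K)) → d ≤ suc (3 + K) → dy₁ s ≡ suc d
      agree-far 0 d e d≤ = ⊥-elim (far-y-large 0 d e d≤ z≤n)
      agree-far 1 d e d≤ = ⊥-elim (far-y-large 1 d e d≤ (s≤s z≤n))
      agree-far 2 d e d≤ = ⊥-elim (far-y-large 2 d e d≤ (s≤s (s≤s z≤n)))
      agree-far s@(suc (suc (suc _))) d e d≤ = dyFar-above s d (far-y s d e) (s≤s d≤)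

  k+k<p : k + k < p
  k+k<p = subst (k + k <_) (sym p≡) ≤-refl

  k+k+1≡p : k + k + 1 ≡ p
  k+k+1≡p = trans (+-comm (k + k) 1) (sym p≡)

  s<2k⇒1+s<p : ∀ s → s < k + k → suc s < p
  s<2k⇒1+s<p s s<2k = subst (suc s <_) (sym p≡) (s≤s s<2k)

  quarter-count : ∀ Q {c f} → QuarterFormula c f → ∀ {a b} → f 0 ≡ a → distX ((c + 0 + n′) % n) ≡ b →
    count< p (λ i → pairsX Q (c + i)) ≡ [ Q a b ] + steps f Q
  quarter-count Q {c} formula f0≡a prev≡b = trans (count<-p (λ i → pairsX Q (c + i))) (cong₂ _+_
    (cong [_] (cong₂ Q (trans (proj₂ formula 0 (s≤s z≤n)) f0≡a) prev≡b))
    (count<-cong (k + k) (λ s s<2k →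
      cong₂ Q (proj₂ formula (suc s) (s<2k⇒1+s<p s s<2k)) (distX-prev formula s (s<2k⇒1+s<p s s<2k)))))

  previous-quarter : ∀ {c f} → QuarterFormula c f → distX ((c + p + 0 + n′) % n) ≡ f (k + k)
  previous-quarter {c} {f} formula = trans (cong distX (begin
    (c + p + 0 + n′) % n   ≡⟨ cong (_% n) (trans (cong (λ q → c + q + 0 + n′) p≡) (lemma c (k + k) n′)) ⟩
    (c + (k + k) + n) % n  ≡⟨ [m+n]%n≡m%n (c + (k + k)) n ⟩
    (c + (k + k)) % n      ≡⟨ quarter-mod formula (k + k) k+k<p ⟩
    c + (k + k)            ∎)) (proj₂ formula (k + k) k+k<p)
    where
      open ≡-Reasoning
      lemma : ∀ c a m → c + suc a + 0 + m ≡ c + a + suc m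
      lemma = solve-∀

  n′≡ : n′ ≡ p + p + p + (k + k)
  n′≡ = lemma K where
    lemma : ∀ K → 3 + 8 * (5 + K) ≡ suc (2 * (5 + K)) + suc (2 * (5 + K)) + suc (2 * (5 + K)) + (5 + K + (5 + K))
    lemma = solve-∀

  x-count : ∀ Q → count< n (pairsX Q)
    ≡ ([ Q 0 1 ] + steps dx₀ Q) + (([ Q 2 3 ] + steps dx₁ Q) + (([ Q 2 3 ] + steps dx₁ Q) + ([ Q 2 3 ] + steps dx₃ Q)))
  x-count Q = trans (count<-4p (pairsX Q)) (cong₂ _+_
    (quarter-count Q formula-q₀ refl wrap)
    (cong₂ _+_ (quarter-count Q formula-q₁ refl (from-previous formula-q₀ dx₀-far))
    (cong₂ _+_ (quarter-count Q formula-q₂ refl (from-previous formula-q₁ dx₁-far))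
               (quarter-count Q formula-q₃ refl (from-previous formula-q₂ dx₁-far)))))
    where
      wrap : distX ((0 + 0 + n′) % n) ≡ 1
      wrap = trans (cong distX (trans (cong (_% n) n′≡) (m<n⇒m%n≡m (q₃<n (k + k) k+k<p))))
                   (trans (distX-q₃ (k + k) k+k<p) (dx₃-far (k + k) 1 k+k+1≡p (s≤s z≤n)))
      from-previous : ∀ {c f} → QuarterFormula c f → (∀ s d → s + d ≡ p → d ≤ k → f s ≡ detour d) →
        distX ((c + p + 0 + n′) % n) ≡ 3
      from-previous formula at-far = trans (previous-quarter formula) (at-far (k + k) 1 k+k+1≡p (s≤s z≤n))

  prev-y : ∀ T → T < h → (suc T + h′) % h ≡ T
  prev-y T T<h = trans (cong (_% h) (sym (+-suc T h′))) (trans ([m+n]%n≡m%n T h) (m<n⇒m%n≡m T<h))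

  dyFar-k+k : dyFar (k + k) ≡ 2
  dyFar-k+k = dyFar-far (k + k) 2 (lemma K) (s≤s (s≤s z≤n))
    where lemma : ∀ K → 5 + K + (5 + K) + 2 ≡ suc (suc (2 * (5 + K)))
          lemma = solve-∀

  y-count : ∀ Q → count< h (pairsY Q) ≡ ([ Q 1 2 ] + steps dy₀ Q) + ([ Q 1 2 ] + steps dy₁ Q)
  y-count Q = begin
    count< h (pairsY Q)                                      ≡⟨ cong (λ m → count< m (pairsY Q)) h≡2p ⟩
    count< (p + p) (pairsY Q)                                ≡⟨ count<-+ p p (pairsY Q) ⟩
    count< p (pairsY Q) + count< p (λ i → pairsY Q (p + i))
      ≡⟨ cong₂ _+_ (trans (count<-p (pairsY Q)) (cong₂ _+_ (cong [_] (cong (Q 1) start₀)) (count<-cong (k + k) steps₀)))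
                   (trans (count<-p (λ i → pairsY Q (p + i)))
                          (cong₂ _+_ (cong [_] (cong₂ Q (distY-q₁ 0) start₁)) (count<-cong (k + k) steps₁))) ⟩
    ([ Q 1 2 ] + steps dy₀ Q) + ([ Q 1 2 ] + steps dy₁ Q) ∎
    where
      open ≡-Reasoning
      h′≡ : h′ ≡ p + (k + k)
      h′≡ = lemma K where
        lemma : ∀ K → 1 + 4 * (5 + K) ≡ suc (2 * (5 + K)) + (5 + K + (5 + K))
        lemma = solve-∀
      s<h : ∀ s → s < p → s < h
      s<h s s<p = <-≤-trans s<p (≤-by p (sym h≡2p))
      p+s<h : ∀ s → s < p → p + s < h
      p+s<h s s<p = subst (p + s <_) (sym h≡2p) (+-monoʳ-< p s<p)
      start₀ : distY (h′ % h) ≡ 2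
      start₀ = trans (cong distY (trans (cong (_% h) h′≡) (m<n⇒m%n≡m (p+s<h (k + k) k+k<p))))
                     (trans (distY-q₁ (k + k)) dyFar-k+k)
      start₁ : distY ((p + 0 + h′) % h) ≡ 2
      start₁ = trans (cong distY (trans (cong (λ r → (r + h′) % h) (trans (+-identityʳ p) p≡))
                                        (prev-y (k + k) (s<h (k + k) k+k<p))))
                     (trans (distY-q₀ (k + k) k+k<p) dyFar-k+k)
      steps₀ : ∀ s → s < k + k → pairsY Q (suc s) ≡ Q (dy₀ (suc s)) (dy₀ s)
      steps₀ s s<2k = let s+1<p = s<2k⇒1+s<p s s<2k ; s<p = <-trans (n<1+n s) s+1<p in
        cong₂ Q (distY-q₀ (suc s) s+1<p) (trans (cong distY (prev-y s (s<h s s<p))) (distY-q₀ s s<p))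
      steps₁ : ∀ s → s < k + k → pairsY Q (p + suc s) ≡ Q (dy₁ (suc s)) (dy₁ s)
      steps₁ s s<2k = let s<p = <-trans (n<1+n s) (s<2k⇒1+s<p s s<2k) in
        cong₂ Q (distY-q₁ (suc s))
          (trans (cong distY (trans (cong (λ r → (r + h′) % h) (+-suc p s)) (prev-y (p + s) (p+s<h s s<p)))) (distY-q₁ s))

  rearrange : ∀ q01 q10 q12 q21 q23 q32 q34 q43 qkk a d s₀ s₁ s₃ t₀ t₁ →
    s₀ ≡ q10 + (q21 + (q32 + a)) + (qkk + (q32 + (q23 + d))) →
    s₁ ≡ q32 + (q23 + (q32 + a)) + (qkk + (q32 + (q23 + d))) →
    s₃ ≡ q32 + (q23 + (q32 + a)) + (qkk + (q12 + (q23 + d))) →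
    t₀ ≡ q21 + (q32 + (q43 + (q34 + a))) + (qkk + (q23 + d)) →
    t₁ ≡ q21 + (q12 + (q21 + (q32 + a))) + (qkk + (q23 + d)) →
    (q01 + s₀) + ((q23 + s₁) + ((q23 + s₁) + (q23 + s₃))) + ((q12 + t₀) + (q12 + t₁))
      ≡ q01 + q10 + 4 * (q12 + q21) + 12 * (q23 + q32) + (q34 + q43) + 6 * (a + d + qkk)
  rearrange q01 q10 q12 q21 q23 q32 q34 q43 qkk a d _ _ _ _ _ refl refl refl refl refl =
    lemma q01 q10 q12 q21 q23 q32 q34 q43 qkk a d
    where
      lemma : ∀ q01 q10 q12 q21 q23 q32 q34 q43 qkk a d →
        (q01 + (q10 + (q21 + (q32 + a)) + (qkk + (q32 + (q23 + d)))))
        + ((q23 + (q32 + (q23 + (q32 + a)) + (qkk + (q32 + (q23 + d)))))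
          + ((q23 + (q32 + (q23 + (q32 + a)) + (qkk + (q32 + (q23 + d)))))
            + (q23 + (q32 + (q23 + (q32 + a)) + (qkk + (q12 + (q23 + d)))))))
        + ((q12 + (q21 + (q32 + (q43 + (q34 + a))) + (qkk + (q23 + d))))
          + (q12 + (q21 + (q12 + (q21 + (q32 + a))) + (qkk + (q23 + d)))))
          ≡ q01 + q10 + 4 * (q12 + q21) + 12 * (q23 + q32) + (q34 + q43) + 6 * (a + d + qkk)
      lemma = solve-∀

  count-edge-rotate : ∀ (Q : ℕ → ℕ → Bool) (j : Fin n) →
    distanceCount k Q (x j) (xv k (toℕ j + 1)) ≡ distanceCount k Q (x fzero) (rotate (x fzero))
  count-edge-rotate Q j = trans (sym (cong₂ (distanceCount k Q) x₀↦xⱼ x₁↦xⱼ₊₁))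
    (Automorphism.distanceCount-to (rotation ^ᴬ toℕ j) Q (x fzero) (rotate (x fzero)))
    where
      x₀↦xⱼ : Automorphism.to (rotation ^ᴬ toℕ j) (x fzero) ≡ x j
      x₀↦xⱼ = trans (rotation^-x (toℕ j) 0) (cong x (X.mod-toℕ j))
      x₁↦xⱼ₊₁ : Automorphism.to (rotation ^ᴬ toℕ j) (rotate (x fzero)) ≡ xv k (toℕ j + 1)
      x₁↦xⱼ₊₁ = trans (rotation^-x (suc (toℕ j)) 0) (cong (λ r → x (r mod NX k)) (+-comm 1 (toℕ j)))

  count-edge-profile : ∀ (Q : ℕ → ℕ → Bool) (j : Fin n) →
    distanceCount k Q (x j) (xv k (toℕ j + 1)) ≡ profile k Q
  count-edge-profile Q j = begin
    distanceCount k Q (x j) (xv k (toℕ j + 1))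
      ≡⟨ count-edge-rotate Q j ⟩
    distanceCount k Q (x fzero) (rotate (x fzero))
      ≡⟨ count-x₀x₁ Q ⟩
    count< n (pairsX Q) + count< h (pairsY Q)
      ≡⟨ cong₂ _+_ (x-count Q) (y-count Q) ⟩
    ([ Q 0 1 ] + steps dx₀ Q) + (([ Q 2 3 ] + steps dx₁ Q) + (([ Q 2 3 ] + steps dx₁ Q) + ([ Q 2 3 ] + steps dx₃ Q)))
      + (([ Q 1 2 ] + steps dy₀ Q) + ([ Q 1 2 ] + steps dy₁ Q))
      ≡⟨ rearrange [ Q 0 1 ] [ Q 1 0 ] [ Q 1 2 ] [ Q 2 1 ] [ Q 2 3 ] [ Q 3 2 ] [ Q 3 4 ] [ Q 4 3 ] [ Q k k ] (up Q) (down Q)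
           (steps dx₀ Q) (steps dx₁ Q) (steps dx₃ Q) (steps dy₀ Q) (steps dy₁ Q)
           (steps-dx₀ Q) (steps-dx₁ Q) (steps-dx₃ Q) (steps-dy₀ Q) (steps-dy₁ Q) ⟩
    profile k Q ∎
    where open ≡-Reasoning

opaque
  unfolding distanceCount

  length-D : ∀ k a b u v → length (D k a b u v) ≡ distanceCount k (at a b) u v
  length-D k a b u v = refl

  length-W : ∀ k u v → length (W k u v) ≡ distanceCount k _<ᵇ_ u v
  length-W k u v = refl

  length-W-flip : ∀ k u v → length (W k v u) ≡ distanceCount k (flip _<ᵇ_) u v
  length-W-flip k u v = refl

length≡0⇒[] : ∀ {A : Set} (xs : List A) → length xs ≡ 0 → xs ≡ []
length≡0⇒[] [] _ = refl

profile-low-ascent : ∀ k b → b < 3 → profile k (at (suc b) b) ≡ nearPairs (at (suc b) b)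
profile-low-ascent k b b<3 = trans (cong (λ f → nearPairs (at (suc b) b) + 6 * f) (farPairs-low-ascent k b b<3)) (+-identityʳ _)

profile-ascent : ∀ k b → 3 ≤ b → b < k → profile k (at (suc b) b) ≡ nearPairs (at (suc b) b) + 6
profile-ascent k b 3≤b b<k = cong (λ f → nearPairs (at (suc b) b) + 6 * f) (farPairs-ascent k b 3≤b b<k)

profile-diagonal : ∀ k i → i < k → profile k (at i i) ≡ 0
profile-diagonal k i i<k = cong₂ (λ a f → a + 6 * f) (nearPairs-diagonal i) (farPairs-diagonal k i i<k)

lemma3p14 : (k : ℕ) → 5 ≤ k → (j : Fin (NX k)) →
    ((length (D k 1 0 (x j) (xv k (toℕ j + 1))) ≡ 1) × (length (D k 0 1 (x j) (xv k (toℕ j + 1))) ≡ 1))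
    × ((length (D k 2 1 (x j) (xv k (toℕ j + 1))) ≡ 4) × (length (D k 1 2 (x j) (xv k (toℕ j + 1))) ≡ 4))
    × ((length (D k 3 2 (x j) (xv k (toℕ j + 1))) ≡ 12) × (length (D k 2 3 (x j) (xv k (toℕ j + 1))) ≡ 12))
    × ((length (D k 4 3 (x j) (xv k (toℕ j + 1))) ≡ 7) × (length (D k 3 4 (x j) (xv k (toℕ j + 1))) ≡ 7))
    × ((ℓ : ℕ) → 4 ≤ ℓ → ℓ ≤ k ∸ 1 →
        (length (D k (suc ℓ) ℓ (x j) (xv k (toℕ j + 1))) ≡ 6)
        × (length (D k ℓ (suc ℓ) (x j) (xv k (toℕ j + 1))) ≡ 6))
    × (length (D k k k (x j) (xv k (toℕ j + 1))) ≡ 6)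
    × Balanced k (x j) (xv k (toℕ j + 1))
    × ((i : ℕ) → 1 ≤ i → i ≤ k ∸ 1 → D k i i (x j) (xv k (toℕ j + 1)) ≡ [])
lemma3p14 k@(suc (suc (suc (suc (suc K))))) (s≤s (s≤s (s≤s (s≤s (s≤s z≤n))))) j =
    pair 1 0 (profile-low-ascent k 0 (s≤s z≤n))
  , pair 2 1 (profile-low-ascent k 1 (s≤s (s≤s z≤n)))
  , pair 3 2 (profile-low-ascent k 2 (s≤s (s≤s (s≤s z≤n))))
  , pair 4 3 (profile-ascent k 3 ≤-refl (s≤s (s≤s (s≤s (s≤s z≤n)))))
  , (λ { ℓ@(suc (suc (suc (suc L)))) (s≤s (s≤s (s≤s (s≤s z≤n)))) ℓ≤k-1 →
         pair (suc ℓ) ℓ (profile-ascent k ℓ (s≤s (s≤s (s≤s z≤n))) (s≤s ℓ≤k-1)) })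
  , trans (edge k k) (cong (6 *_) (farPairs-top k))
  , balanced
  , (λ i _ i≤k-1 → length≡0⇒[] _ (trans (edge i i) (profile-diagonal k i (s≤s i≤k-1))))
  where
    open ≡-Reasoning
    edge-profile : ∀ (Q : ℕ → ℕ → Bool) → distanceCount k Q (x j) (xv k (toℕ j + 1)) ≡ profile k Q
    edge-profile Q = EdgeProfile.count-edge-profile K Q j
    edge : ∀ a b → length (D k a b (x j) (xv k (toℕ j + 1))) ≡ profile k (at a b)
    edge a b = trans (length-D k a b (x j) (xv k (toℕ j + 1))) (edge-profile (at a b))
    -- nearPairs (at a b) evaluates by computation: to 1, 4, 12, 1 for (a, b) = (1,0), (2,1), (3,2), (4,3),
    -- and to 0 whenever a ≥ 5.
    pair : ∀ a b {c} → profile k (at a b) ≡ c →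
      (length (D k a b (x j) (xv k (toℕ j + 1))) ≡ c) × (length (D k b a (x j) (xv k (toℕ j + 1))) ≡ c)
    pair a b eq = trans (edge a b) eq , trans (edge b a) (trans (profile-at-swap k a b) eq)
    balanced : Balanced k (x j) (xv k (toℕ j + 1))
    balanced = begin
      length (W k (x j) (xv k (toℕ j + 1)))                ≡⟨ length-W k (x j) (xv k (toℕ j + 1)) ⟩
      distanceCount k _<ᵇ_ (x j) (xv k (toℕ j + 1))        ≡⟨ edge-profile _<ᵇ_ ⟩
      profile k _<ᵇ_                                       ≡⟨ profile-flip k _<ᵇ_ ⟨
      profile k (flip _<ᵇ_)                                ≡⟨ edge-profile (flip _<ᵇ_) ⟨
      distanceCount k (flip _<ᵇ_) (x j) (xv k (toℕ j + 1)) ≡⟨ length-W-flip k (x j) (xv k (toℕ j + 1)) ⟨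
      length (W k (xv k (toℕ j + 1)) (x j))                ∎
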